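{- Let $\Delta$ be a finite spherical building with complete apartment system $\mathcal{A}$. Let $C$ and $\overline{C}$ be opposite chambers of $\Delta$ and let $D$ be any chamber in the apartment containing $C$ and $\overline{C}$. Then $|\mathcal{A}_{C,D}|\cdot|\mathcal{A}_{D,\overline{C}}|=|\mathcal{A}_D|$.
   Context: For chambers $X,Y$, $\mathcal{A}_X$ denotes the set of apartments in $\mathcal{A}$ containing $X$, and $\mathcal{A}_{X,Y}$ the set of apartments in $\mathcal{A}$ containing both $X$ and $Y$. Two opposite chambers lie in a unique apartment (the convex hull of the two chambers). -}

module Defs where

open import Level using (0ℓ)
open import Data.Nat using (ℕ; zero; suc; _≤_)
open import Data.Fin using (Fin)
open import Data.Fin.Subset using (Subset) renaming (_∈_ to _∈ₛ_)
open import Data.Vec using (Vec; []; _∷_)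
open import Data.List using (List; length)
open import Data.List.Relation.Unary.Any using (Any)
open import Data.List.Relation.Unary.Unique.Propositional using (Unique)
import Data.List.Membership.Propositional as LMem
open import Data.Product using (Σ; Σ-syntax; ∃; ∃-syntax; _×_)
open import Data.Sum using (_⊎_)
open import Relation.Nullary using (¬_)
open import Relation.Binary.PropositionalEquality using (_≡_)
open import Function.Bundles using (_⇔_)
open import Algebra.Bundles using (Group)

module _ (G : Group 0ℓ 0ℓ) where
  open Group G

  pow : Carrier → ℕ → Carrier
  pow x zero    = ε
  pow x (suc k) = x ∙ pow x k

  prodWord : {I : Set} (g : I → Carrier) {n : ℕ} → Vec I n → Carrier
  prodWord g []       = ε
  prodWord g (i ∷ is) = g i ∙ prodWord g is

-- Coxeter systems (W , S), with S = image of  gen : Fin r → W.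
-- Defined by the Coxeter presentation, via its universal property:
-- any map f : S → G into a group such that every relation
-- (s t)^k = 1 holding in W also holds for the f-images extends to a
-- homomorphism W → G.

record CoxeterSystem : Set₁ where
  field
    W   : Group 0ℓ 0ℓ
  open Group W public
  field
    rank      : ℕ
    gen       : Fin rank → Carrier
    gen-inj   : ∀ s t → gen s ≈ gen t → s ≡ t
    gen-nontriv : ∀ s → ¬ (gen s ≈ ε)
    gen-invol : ∀ s → gen s ∙ gen s ≈ ε
    generates : ∀ w → ∃[ n ] Σ (Vec (Fin rank) n) (λ ws → prodWord W gen ws ≈ w)
    presentation :
      (G : Group 0ℓ 0ℓ) (f : Fin rank → Group.Carrier G) →
      (∀ s t k → pow W (gen s ∙ gen t) k ≈ ε →
         Group._≈_ G (pow G (Group._∙_ G (f s) (f t)) k) (Group.ε G)) →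
      Σ[ h ∈ (Carrier → Group.Carrier G) ]
        ((∀ {x y} → x ≈ y → Group._≈_ G (h x) (h y)) ×
         (∀ x y → Group._≈_ G (h (x ∙ y)) (Group._∙_ G (h x) (h y))) ×
         (∀ s → Group._≈_ G (h (gen s)) (f s)))

  HasWord : Carrier → ℕ → Set
  HasWord w n = Σ (Vec (Fin rank) n) (λ ws → prodWord W gen ws ≈ w)

  LengthIs : Carrier → ℕ → Set
  LengthIs w n = HasWord w n × (∀ m → HasWord w m → n ≤ m)

  Finite : Set
  Finite = Σ[ l ∈ List Carrier ] (∀ w → Any (w ≈_) l)

-- Buildings of type (W , S) as W-metric spaces (Abramenko–Brown, Ch. 5),
-- with a finite set of chambers  Fin N.

module _ (WS : CoxeterSystem) where
  open CoxeterSystem WS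

  record Building (N : ℕ) : Set where
    field
      δ : Fin N → Fin N → Carrier
      WD1 : ∀ C D → (δ C D ≈ ε) ⇔ (C ≡ D)
      WD2 : ∀ C D C' s → δ C' C ≈ gen s →
              (δ C' D ≈ gen s ∙ δ C D) ⊎ (δ C' D ≈ δ C D)
      WD2' : ∀ C D C' s → δ C' C ≈ gen s →
               (∀ n → LengthIs (δ C D) n → LengthIs (gen s ∙ δ C D) (suc n)) →
               δ C' D ≈ gen s ∙ δ C D
      WD3 : ∀ C D s → Σ[ C' ∈ Fin N ] (δ C' C ≈ gen s × δ C' D ≈ gen s ∙ δ C D)

    Opposite : Fin N → Fin N → Set
    Opposite C D = ∀ w n m → LengthIs (δ C D) n → LengthIs w m → m ≤ n

    -- Σ is an apartment of the complete apartment system: the image of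
    -- an isometry  α : W → chambers  (δ(α u, α v) = u⁻¹ v).
    IsApartment : Subset N → Set
    IsApartment A =
      Σ[ α ∈ (Carrier → Fin N) ]
        ((∀ u v → δ (α u) (α v) ≈ u ⁻¹ ∙ v) ×
         (∀ C → (C ∈ₛ A) ⇔ (∃[ w ] α w ≡ C)))

-- Cardinality of a (possibly non-decidable) family of subsets:
-- k is the number of subsets satisfying P.

HasCard : {N : ℕ} → (Subset N → Set) → ℕ → Set
HasCard {N} P k =
  Σ[ L ∈ List (Subset N) ]
    (Unique L × (∀ A → (A LMem.∈ L) ⇔ P A) × length L ≡ k)

{-# OPTIONS --safe #-}

-- Put u = δ(D, C) and e = δ(D, C̄). In the apartment through C, C̄ and D,
-- u⁻¹e = δ(C, C̄) is the longest element w₀ of W, so ℓ(u⁻¹) + ℓ(e) = ℓ(w₀).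
-- An apartment through D contains exactly one chamber Y with δ(D, Y) = u and
-- exactly one chamber Z with δ(D, Z) = e. Conversely, for any such Y and Z the
-- reduced factorisation w₀ = u⁻¹e forces δ(Y, Z) = w₀; the convex hull of the
-- opposite chambers Y, Z is the unique apartment containing both, and it
-- contains D. So 𝒜_D is in bijection with the pairs (Y, Z), 𝒜_{C,D} with the
-- Z (as Y = C) and 𝒜_{D,C̄} with the Y (as Z = C̄).
--
-- The facts about W that this needs (the exchange condition and
-- ℓ(w₀y) + ℓ(y) = ℓ(w₀)) are derived from the Coxeter presentation through
-- Tits' reflection cocycle.

module Submission where

open import Defs
open import Level using (0ℓ)
open import Data.Nat using (ℕ; zero; suc; _+_; _*_; _≤_; _<_; z≤n; s≤s)
import Data.Nat.Properties as ℕ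
open import Data.Bool using (Bool; true; false; not; _xor_)
import Data.Bool.Properties as Bool
open import Data.Fin using (Fin)
import Data.Fin as Fin
open import Data.Fin.Properties using (any?)
open import Data.Fin.Subset using (Subset; _∈_)
open import Data.Fin.Subset.Properties using (⊆-antisym)
open import Data.Vec using (Vec; []; _∷_; _++_; _∷ʳ_; tabulate)
import Data.Vec.Properties as Vec
open import Data.List using (List; []; _∷_; length; map; filter; allFin; cartesianProduct)
import Data.List.Properties as List
open import Data.List.Membership.Propositional using () renaming (_∈_ to _∈ₗ_)
open import Data.List.Membership.Propositional.Properties
  using (∈-map⁺; ∈-map⁻; ∈-filter⁺; ∈-filter⁻; ∈-allFin; ∈-cartesianProduct⁺; ∈-cartesianProduct⁻)
open import Data.List.Membership.Propositional.Properties.WithK using (unique∧set⇒bag)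
open import Data.List.Relation.Binary.BagAndSetEquality using (∼bag⇒↭)
open import Data.List.Relation.Binary.Permutation.Propositional.Properties using (↭-length)
import Data.List.Relation.Unary.All as All
import Data.List.Relation.Unary.All.Properties as All
open import Data.List.Relation.Unary.Any using (here; there)
open import Data.List.Relation.Unary.AllPairs using ([]; _∷_)
open import Data.List.Relation.Unary.Unique.Propositional using (Unique)
import Data.List.Relation.Unary.Unique.Propositional.Properties as Unique
open import Data.Product using (∃; ∃-syntax; Σ-syntax; _×_; _,_; proj₁; proj₂)
open import Data.Sum using (_⊎_; inj₁; inj₂; [_,_]′)
open import Data.Empty using (⊥-elim)
open import Function.Bundles using (_⇔_; mk⇔; Equivalence)
open import Relation.Nullary using (¬_; Dec; yes; no; does)
open import Relation.Nullary.Decidable using (does-⇔; dec-true)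
import Relation.Nullary.Decidable as Dec
open import Relation.Unary using (Pred; Decidable)
open import Relation.Binary.PropositionalEquality using (_≡_)
import Relation.Binary.PropositionalEquality as ≡
open import Algebra.Bundles using (Group)
import Algebra.Properties.Group as GroupProperties
import Relation.Binary.Reasoning.Setoid as ≈-Reasoning

module _ {P : Pred ℕ 0ℓ} (P? : Decidable P) where

  private
    search : ∀ n → (∃[ m ] P m × ∀ j → P j → m ≤ j) ⊎ (∀ j → j < n → ¬ P j)
    search zero = inj₂ λ _ ()
    search (suc n) with search n
    ... | inj₁ found = inj₁ found
    ... | inj₂ none with P? n
    ...   | yes pn = inj₁ (n , pn , λ j pj → ℕ.≮⇒≥ λ j<n → none j j<n pj)
    ...   | no ¬pn = inj₂ λ j j<1+n pj → [ (λ j<n → none j j<n pj) , (λ { ≡.refl → ¬pn pj }) ]′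
                                           (ℕ.m≤n⇒m<n∨m≡n (ℕ.≤-pred j<1+n))

  least : ∀ {n} → P n → ∃[ m ] P m × ∀ j → P j → m ≤ j
  least {n} pn with search (suc n)
  ... | inj₁ found = found
  ... | inj₂ none  = ⊥-elim (none n (ℕ.n<1+n n) pn)

xor-cancelʳ : ∀ b x → (b xor x) xor x ≡ b
xor-cancelʳ b x = begin
  (b xor x) xor x   ≡⟨ Bool.xor-assoc b x x ⟩
  b xor (x xor x)   ≡⟨ ≡.cong (b xor_) (Bool.xor-same x) ⟩
  b xor false       ≡⟨ Bool.xor-identityʳ b ⟩
  b                 ∎
  where open ≡.≡-Reasoning

xor≡false⇒≡ : ∀ x y → x xor y ≡ false → x ≡ y
xor≡false⇒≡ false false _  = ≡.refl
xor≡false⇒≡ true  true  _  = ≡.refl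
xor≡false⇒≡ false true  ()
xor≡false⇒≡ true  false ()

parity : (ℕ → Bool) → ℕ → Bool
parity f zero    = false
parity f (suc n) = parity f n xor f n

parity-cong : ∀ {f g} → (∀ j → f j ≡ g j) → ∀ n → parity f n ≡ parity g n
parity-cong f≗g zero    = ≡.refl
parity-cong f≗g (suc n) = ≡.cong₂ _xor_ (parity-cong f≗g n) (f≗g n)

parity-+ : ∀ f m n → parity f (m + n) ≡ parity f m xor parity (λ j → f (m + j)) n
parity-+ f m zero    rewrite ℕ.+-identityʳ m = ≡.sym (Bool.xor-identityʳ _)
parity-+ f m (suc n) rewrite ℕ.+-suc m n =
  ≡.trans (≡.cong (_xor f (m + n)) (parity-+ f m n)) (Bool.xor-assoc (parity f m) _ _)

parity-periodic : ∀ f k → (∀ j → f (k + j) ≡ f j) → parity f (k * 2) ≡ false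
parity-periodic f k periodic = begin
  parity f (k * 2)                                ≡⟨ ≡.cong (parity f) (ℕ.*-comm k 2) ⟩
  parity f (k + (k + 0))                          ≡⟨ ≡.cong (λ n → parity f (k + n)) (ℕ.+-identityʳ k) ⟩
  parity f (k + k)                                ≡⟨ parity-+ f k k ⟩
  parity f k xor parity (λ j → f (k + j)) k       ≡⟨ ≡.cong (parity f k xor_) (parity-cong periodic k) ⟩
  parity f k xor parity f k                       ≡⟨ Bool.xor-same (parity f k) ⟩
  false                                           ∎
  where open ≡.≡-Reasoning

fromDec : ∀ {n} {P : Pred (Fin n) 0ℓ} → Decidable P → Subset n
fromDec P? = tabulate (λ X → does (P? X))

∈-fromDec : ∀ {n} {P : Pred (Fin n) 0ℓ} (P? : Decidable P) {X} → X ∈ fromDec P? ⇔ P X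
∈-fromDec P? {X} = mk⇔ to (λ pX → Vec.lookup⇒[]= X _ (≡.trans (Vec.lookup∘tabulate _ X) (dec-true (P? X) pX)))
  where
  to : X ∈ fromDec P? → _
  to X∈ with P? X | ≡.trans (≡.sym (Vec.lookup∘tabulate _ X)) (Vec.[]=⇒lookup X∈)
  ... | yes pX | _  = pX
  ... | no _   | ()

length-cartesianProduct : ∀ {A B : Set} (xs : List A) (ys : List B) →
                          length (cartesianProduct xs ys) ≡ length xs * length ys
length-cartesianProduct []       ys = ≡.refl
length-cartesianProduct (x ∷ xs) ys = ≡.trans (List.length-++ (map (x ,_) ys))
  (≡.cong₂ _+_ (List.length-map (x ,_) ys) (length-cartesianProduct xs ys))

module _ {A B : Set} (f : A → B) where

  InjectiveOn : List A → Set
  InjectiveOn xs = ∀ {x y} → x ∈ₗ xs → y ∈ₗ xs → f x ≡ f y → x ≡ y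

  map-unique : ∀ {xs} → InjectiveOn xs → Unique xs → Unique (map f xs)
  map-unique {[]}     _   []          = []
  map-unique {x ∷ xs} inj (x∉xs ∷ u) =
    All.map⁺ (All.tabulate λ y∈xs fx≡fy → All.lookup x∉xs y∈xs (inj (here ≡.refl) (there y∈xs) fx≡fy))
    ∷ map-unique (λ x∈ y∈ → inj (there x∈) (there y∈)) u


HasCard-image : ∀ {A : Set} {N} {P : Subset N → Set} (f : A → Subset N) {xs k} →
                Unique xs → InjectiveOn f xs →
                (∀ {x} → x ∈ₗ xs → P (f x)) → (∀ {S} → P S → ∃[ x ] x ∈ₗ xs × f x ≡ S) →
                HasCard P k → k ≡ length xs
HasCard-image {P = P} f {xs} {k} unique injective into onto (L , uniqueL , L⇔P , lengthL≡k) = begin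
  k                  ≡⟨ lengthL≡k ⟨
  length L           ≡⟨ ↭-length (∼bag⇒↭ (unique∧set⇒bag uniqueL (map-unique f injective unique) L≈fxs)) ⟩
  length (map f xs)  ≡⟨ List.length-map f xs ⟩
  length xs          ∎
  where
  open ≡.≡-Reasoning
  L≈fxs : ∀ {S} → S ∈ₗ L ⇔ S ∈ₗ map f xs
  L≈fxs {S} = mk⇔
    (λ S∈L → let x , x∈xs , fx≡S = onto (Equivalence.to (L⇔P S) S∈L)
             in ≡.subst (_∈ₗ map f xs) fx≡S (∈-map⁺ f x∈xs))
    (λ S∈fxs → let x , x∈xs , S≡fx = ∈-map⁻ f S∈fxs
               in Equivalence.from (L⇔P S) (≡.subst P (≡.sym S≡fx) (into x∈xs)))

module CoxeterLength (WS : CoxeterSystem)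
                     (_≈?_ : ∀ x y → Dec (CoxeterSystem._≈_ WS x y)) where
  open CoxeterSystem WS
  open GroupProperties W

  Word : ℕ → Set
  Word = Vec (Fin rank)

  ⟦_⟧ : ∀ {n} → Word n → Carrier
  ⟦_⟧ = prodWord W gen

  ⟦⟧-++ : ∀ {m n} (xs : Word m) (ys : Word n) → ⟦ xs ++ ys ⟧ ≈ ⟦ xs ⟧ ∙ ⟦ ys ⟧
  ⟦⟧-++ []       ys = sym (identityˡ _)
  ⟦⟧-++ (x ∷ xs) ys = trans (∙-congˡ (⟦⟧-++ xs ys)) (sym (assoc _ _ _))

  ⟦⟧-∷ʳ : ∀ {n} (xs : Word n) s → ⟦ xs ∷ʳ s ⟧ ≈ ⟦ xs ⟧ ∙ gen s
  ⟦⟧-∷ʳ []       s = trans (identityʳ _) (sym (identityˡ _))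
  ⟦⟧-∷ʳ (x ∷ xs) s = trans (∙-congˡ (⟦⟧-∷ʳ xs s)) (sym (assoc _ _ _))

  gen⁻¹ : ∀ s → gen s ⁻¹ ≈ gen s
  gen⁻¹ s = sym (inverseʳ-unique (gen s) (gen s) (gen-invol s))

  gen-cancelˡ : ∀ s y → gen s ∙ (gen s ∙ y) ≈ y
  gen-cancelˡ s y = trans (sym (assoc _ _ _)) (trans (∙-congʳ (gen-invol s)) (identityˡ y))

  gen-cancelʳ : ∀ y s → y ∙ gen s ∙ gen s ≈ y
  gen-cancelʳ y s = trans (assoc _ _ _) (trans (∙-congˡ (gen-invol s)) (identityʳ y))

  HasWord-cong : ∀ {w v n} → w ≈ v → HasWord w n → HasWord v n
  HasWord-cong w≈v (ws , ⟦ws⟧≈w) = ws , trans ⟦ws⟧≈w w≈v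

  HasWord-⁻¹ : ∀ {w n} → HasWord w n → HasWord (w ⁻¹) n
  HasWord-⁻¹ ([] , ε≈w) = [] , trans (sym ε⁻¹≈ε) (⁻¹-cong ε≈w)
  HasWord-⁻¹ {w} (s ∷ ws , ⟦sws⟧≈w) with HasWord-⁻¹ (ws , refl)
  ... | vs , ⟦vs⟧≈⟦ws⟧⁻¹ = vs ∷ʳ s , (begin
    ⟦ vs ∷ʳ s ⟧              ≈⟨ ⟦⟧-∷ʳ vs s ⟩
    ⟦ vs ⟧ ∙ gen s           ≈⟨ ∙-cong ⟦vs⟧≈⟦ws⟧⁻¹ (sym (gen⁻¹ s)) ⟩
    ⟦ ws ⟧ ⁻¹ ∙ gen s ⁻¹     ≈⟨ ⁻¹-anti-homo-∙ _ _ ⟨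
    (gen s ∙ ⟦ ws ⟧) ⁻¹      ≈⟨ ⁻¹-cong ⟦sws⟧≈w ⟩
    w ⁻¹                     ∎)
    where open ≈-Reasoning setoid

  HasWord? : ∀ w n → Dec (HasWord w n)
  HasWord? w n = ∃-word? n (λ ws → ⟦ ws ⟧ ≈? w)
    where
    ∃-word? : ∀ n {Q : Word n → Set} → (∀ ws → Dec (Q ws)) → Dec (∃ Q)
    ∃-word? zero    Q? with Q? []
    ... | yes q = yes ([] , q)
    ... | no ¬q = no λ { ([] , q) → ¬q q }
    ∃-word? (suc n) Q? with any? (λ s → ∃-word? n (λ ws → Q? (s ∷ ws)))
    ... | yes (s , ws , q) = yes (s ∷ ws , q)
    ... | no ¬q            = no λ { (s ∷ ws , q) → ¬q (s , ws , q) }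

  -- Opaque, so that Agda never tries to evaluate the exhaustive search for a shortest word.
  opaque
    private
      shortest : ∀ w → ∃[ m ] HasWord w m × ∀ j → HasWord w j → m ≤ j
      shortest w = least (HasWord? w) (proj₂ (generates w))

    ℓ : Carrier → ℕ
    ℓ w = proj₁ (shortest w)

    ℓ-word : ∀ w → HasWord w (ℓ w)
    ℓ-word w = proj₁ (proj₂ (shortest w))

    ℓ-minimal : ∀ {w n} → HasWord w n → ℓ w ≤ n
    ℓ-minimal {w} = proj₂ (proj₂ (shortest w)) _

  LengthIs-ℓ : ∀ w → LengthIs w (ℓ w)
  LengthIs-ℓ w = ℓ-word w , λ _ → ℓ-minimal

  LengthIs⇒≡ℓ : ∀ {w n} → LengthIs w n → n ≡ ℓ w
  LengthIs⇒≡ℓ (hasWord , minimal) = ℕ.≤-antisym (minimal _ (ℓ-word _)) (ℓ-minimal hasWord)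

  ℓ-cong : ∀ {w v} → w ≈ v → ℓ w ≡ ℓ v
  ℓ-cong w≈v = ℕ.≤-antisym (ℓ-minimal (HasWord-cong (sym w≈v) (ℓ-word _)))
                           (ℓ-minimal (HasWord-cong w≈v (ℓ-word _)))

  ℓ≡0⇒≈ε : ∀ {w} → ℓ w ≡ 0 → w ≈ ε
  ℓ≡0⇒≈ε {w} ℓw≡0 = emptyWord ℓw≡0 (ℓ-word w)
    where
    emptyWord : ∀ {m} → m ≡ 0 → HasWord w m → w ≈ ε
    emptyWord ≡.refl ([] , ε≈w) = sym ε≈w

  ℓ-gen : ∀ s → ℓ (gen s) ≡ 1
  ℓ-gen s with ℓ (gen s) in ℓs | ℓ-minimal {gen s} (s ∷ [] , identityʳ _)
  ... | zero  | _       = ⊥-elim (gen-nontriv s (ℓ≡0⇒≈ε ℓs))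
  ... | suc _ | s≤s z≤n = ≡.refl

  ℓ-∙ : ∀ v w → ℓ (v ∙ w) ≤ ℓ v + ℓ w
  ℓ-∙ v w with ℓ-word v | ℓ-word w
  ... | vs , ⟦vs⟧≈v | ws , ⟦ws⟧≈w =
    ℓ-minimal (vs ++ ws , trans (⟦⟧-++ vs ws) (∙-cong ⟦vs⟧≈v ⟦ws⟧≈w))

  ℓ-⁻¹ : ∀ w → ℓ (w ⁻¹) ≡ ℓ w
  ℓ-⁻¹ w = ℕ.≤-antisym (ℓ-minimal (HasWord-⁻¹ (ℓ-word w)))
                       (ℓ-minimal (HasWord-cong (⁻¹-involutive w) (HasWord-⁻¹ (ℓ-word (w ⁻¹)))))

  ℓ-gen∙ : ∀ s w → ℓ (gen s ∙ w) ≤ suc (ℓ w)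
  ℓ-gen∙ s w with ℓ-word w
  ... | ws , ⟦ws⟧≈w = ℓ-minimal (s ∷ ws , ∙-congˡ ⟦ws⟧≈w)

  ℓ-∙gen : ∀ w s → ℓ (w ∙ gen s) ≤ suc (ℓ w)
  ℓ-∙gen w s with ℓ-word w
  ... | ws , ⟦ws⟧≈w = ℓ-minimal (ws ∷ʳ s , trans (⟦⟧-∷ʳ ws s) (∙-congʳ ⟦ws⟧≈w))

  ℓ-≤-gen∙ : ∀ s w → ℓ w ≤ suc (ℓ (gen s ∙ w))
  ℓ-≤-gen∙ s w = ≡.subst (_≤ suc (ℓ (gen s ∙ w))) (ℓ-cong (gen-cancelˡ s w)) (ℓ-gen∙ s (gen s ∙ w))

  ℓ-≤-∙gen : ∀ w s → ℓ w ≤ suc (ℓ (w ∙ gen s))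
  ℓ-≤-∙gen w s = ≡.subst (_≤ suc (ℓ (w ∙ gen s))) (ℓ-cong (gen-cancelʳ w s)) (ℓ-∙gen (w ∙ gen s) s)

  leftDescent : ∀ {n} w → ℓ w ≡ suc n → ∃[ s ] ℓ (gen s ∙ w) ≡ n
  leftDescent {n} w ℓw≡1+n = s , ℕ.≤-antisym (ℓ-minimal rest) longer
    where
    uncons : ∀ {m} → m ≡ suc n → HasWord w m → ∃[ s ] HasWord (gen s ∙ w) n
    uncons ≡.refl (s ∷ ws , ⟦sws⟧≈w) =
      s , ws , sym (trans (∙-congˡ (sym ⟦sws⟧≈w)) (gen-cancelˡ s ⟦ ws ⟧))
    s = proj₁ (uncons ℓw≡1+n (ℓ-word w))
    rest = proj₂ (uncons ℓw≡1+n (ℓ-word w))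
    longer : n ≤ ℓ (gen s ∙ w)
    longer = ℕ.≤-pred (≡.subst (_≤ suc (ℓ (gen s ∙ w))) ℓw≡1+n (ℓ-≤-gen∙ s w))

  Longest : Carrier → Set
  Longest w = ∀ v → ℓ v ≤ ℓ w

  Longest-cong : ∀ {w w′} → w ≈ w′ → Longest w → Longest w′
  Longest-cong w≈w′ longest v = ≡.subst (ℓ v ≤_) (ℓ-cong w≈w′) (longest v)

  Reduced : Carrier → Carrier → Set
  Reduced a b = ℓ (a ∙ b) ≡ ℓ a + ℓ b

  Reduced-gen∙ : ∀ s {x} → ℓ (gen s ∙ x) ≡ suc (ℓ x) → Reduced (gen s) x
  Reduced-gen∙ s {x} longer = ≡.trans longer (≡.cong (_+ ℓ x) (≡.sym (ℓ-gen s)))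

  Reduced-∙gen : ∀ {x} s → ℓ (x ∙ gen s) ≡ suc (ℓ x) → Reduced x (gen s)
  Reduced-∙gen {x} s longer = ≡.trans longer (≡.trans (ℕ.+-comm 1 (ℓ x)) (≡.cong (ℓ x +_) (≡.sym (ℓ-gen s))))

  Reduced-dropˡ : ∀ s {a} b {n} → ℓ a ≡ suc n → ℓ (gen s ∙ a) ≡ n → Reduced a b → Reduced (gen s ∙ a) b
  Reduced-dropˡ s {a} b {n} ℓa≡1+n ℓsa≡n reduced = ℕ.≤-antisym (ℓ-∙ _ _) (ℕ.≤-pred (begin
    suc (ℓ (gen s ∙ a) + ℓ b)     ≡⟨ ≡.cong (λ m → suc m + ℓ b) ℓsa≡n ⟩
    suc n + ℓ b                   ≡⟨ ≡.cong (_+ ℓ b) ℓa≡1+n ⟨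
    ℓ a + ℓ b                     ≡⟨ reduced ⟨
    ℓ (a ∙ b)                     ≡⟨ ℓ-cong (trans (sym (assoc _ _ _)) (∙-congʳ (gen-cancelˡ s a))) ⟨
    ℓ (gen s ∙ (gen s ∙ a ∙ b))   ≤⟨ ℓ-gen∙ s _ ⟩
    suc (ℓ (gen s ∙ a ∙ b))       ∎))
    where open ℕ.≤-Reasoning

module ReflectionCocycle (WS : CoxeterSystem)
                         (_≈?_ : ∀ x y → Dec (CoxeterSystem._≈_ WS x y)) where
  open CoxeterSystem WS
  open GroupProperties W
  open CoxeterLength WS _≈?_

  conj : Carrier → Carrier → Carrier
  conj c r = c ∙ r ∙ c ⁻¹

  conj-cong : ∀ {c c′ r r′} → c ≈ c′ → r ≈ r′ → conj c r ≈ conj c′ r′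
  conj-cong c≈c′ r≈r′ = ∙-cong (∙-cong c≈c′ r≈r′) (⁻¹-cong c≈c′)

  conj-∙ : ∀ a b r → conj (a ∙ b) r ≈ conj a (conj b r)
  conj-∙ a b r = begin
    a ∙ b ∙ r ∙ (a ∙ b) ⁻¹          ≈⟨ ∙-cong (assoc a b r) (⁻¹-anti-homo-∙ a b) ⟩
    a ∙ (b ∙ r) ∙ (b ⁻¹ ∙ a ⁻¹)     ≈⟨ assoc _ _ _ ⟨
    a ∙ (b ∙ r) ∙ b ⁻¹ ∙ a ⁻¹       ≈⟨ ∙-congʳ (assoc _ _ _) ⟩
    a ∙ (b ∙ r ∙ b ⁻¹) ∙ a ⁻¹       ∎
    where open ≈-Reasoning setoid

  conj-ε : ∀ r → conj ε r ≈ r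
  conj-ε r = trans (∙-cong (identityˡ r) ε⁻¹≈ε) (identityʳ r)

  conj-⁻¹ˡ : ∀ c r → conj (c ⁻¹) (conj c r) ≈ r
  conj-⁻¹ˡ c r = trans (sym (conj-∙ (c ⁻¹) c r)) (trans (conj-cong (inverseˡ c) refl) (conj-ε r))

  conj-⁻¹ʳ : ∀ c r → conj c (conj (c ⁻¹) r) ≈ r
  conj-⁻¹ʳ c r = trans (sym (conj-∙ c (c ⁻¹) r)) (trans (conj-cong (inverseʳ c) refl) (conj-ε r))

  conj-transpose : ∀ {c x y} → conj c x ≈ y → x ≈ conj (c ⁻¹) y
  conj-transpose {c} {x} cx≈y = trans (sym (conj-⁻¹ˡ c x)) (conj-cong refl cx≈y)

  conj-transpose⁻ : ∀ {c x y} → x ≈ conj (c ⁻¹) y → conj c x ≈ y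
  conj-transpose⁻ {c} {x} {y} x≈c⁻¹y = trans (conj-cong refl x≈c⁻¹y) (conj-⁻¹ʳ c y)

  conj-self : ∀ c → conj c c ≈ c
  conj-self c = //-rightDividesʳ c c

  conj-gen-gen : ∀ s r → conj (gen s) r ≈ gen s → r ≈ gen s
  conj-gen-gen s r sr≈s = trans (conj-transpose sr≈s) (trans (conj-cong (gen⁻¹ s) refl) (conj-self (gen s)))

  conj-gen-invol : ∀ s r → conj (gen s) (conj (gen s) r) ≈ r
  conj-gen-invol s r = trans (sym (conj-∙ (gen s) (gen s) r)) (trans (conj-cong (gen-invol s) refl) (conj-ε r))

  conj-homo-∙ : ∀ x y z → conj x y ∙ conj x z ≈ conj x (y ∙ z)
  conj-homo-∙ x y z = begin
    x ∙ y ∙ x ⁻¹ ∙ (x ∙ z ∙ x ⁻¹)    ≈⟨ assoc _ _ _ ⟨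
    x ∙ y ∙ x ⁻¹ ∙ (x ∙ z) ∙ x ⁻¹    ≈⟨ ∙-congʳ (assoc _ _ _) ⟩
    x ∙ y ∙ (x ⁻¹ ∙ (x ∙ z)) ∙ x ⁻¹  ≈⟨ ∙-congʳ (∙-congˡ (\\-leftDividesʳ x z)) ⟩
    x ∙ y ∙ z ∙ x ⁻¹                 ≈⟨ ∙-congʳ (assoc _ _ _) ⟩
    x ∙ (y ∙ z) ∙ x ⁻¹               ∎
    where open ≈-Reasoning setoid

  [_≟_] : Carrier → Carrier → Bool
  [ x ≟ y ] = does (x ≈? y)

  ≟-⇔ : ∀ {x y x′ y′} → (x ≈ y ⇔ x′ ≈ y′) → [ x ≟ y ] ≡ [ x′ ≟ y′ ]
  ≟-⇔ {x} {y} {x′} {y′} x≈y⇔x′≈y′ = does-⇔ x≈y⇔x′≈y′ (x ≈? y) (x′ ≈? y′)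

  ≟-cong : ∀ {x y x′ y′} → x ≈ x′ → y ≈ y′ → [ x ≟ y ] ≡ [ x′ ≟ y′ ]
  ≟-cong x≈x′ y≈y′ = ≟-⇔ (mk⇔ (λ x≈y → trans (sym x≈x′) (trans x≈y y≈y′))
                                 (λ x′≈y′ → trans x≈x′ (trans x′≈y′ (sym y≈y′))))

  ≟-true : ∀ {x y} → [ x ≟ y ] ≡ true → x ≈ y
  ≟-true {x} {y} e with x ≈? y | e
  ... | yes x≈y | _  = x≈y
  ... | no _    | ()

  Point : Set
  Point = Carrier × Bool

  infix 4 _≋_
  _≋_ : Point → Point → Set
  p ≋ q = proj₁ p ≈ proj₁ q × proj₂ p ≡ proj₂ q

  ≋-refl : ∀ {p} → p ≋ p
  ≋-refl = refl , ≡.refl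

  ≋-sym : ∀ {p q} → p ≋ q → q ≋ p
  ≋-sym (r≈ , b≡) = sym r≈ , ≡.sym b≡

  ≋-trans : ∀ {p q o} → p ≋ q → q ≋ o → p ≋ o
  ≋-trans (r≈ , b≡) (r≈′ , b≡′) = trans r≈ r≈′ , ≡.trans b≡ b≡′

  record Perm : Set where
    field
      to from     : Point → Point
      to-cong     : ∀ {p q} → p ≋ q → to p ≋ to q
      from-cong   : ∀ {p q} → p ≋ q → from p ≋ from q
      to-from     : ∀ p → to (from p) ≋ p
      from-to     : ∀ p → from (to p) ≋ p
  open Perm

  infix 4 _≈ₚ_
  _≈ₚ_ : Perm → Perm → Set
  σ ≈ₚ τ = ∀ p → to σ p ≋ to τ p

  infixr 9 _∘ₚ_
  _∘ₚ_ : Perm → Perm → Perm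
  σ ∘ₚ τ = record
    { to        = λ p → to σ (to τ p)
    ; from      = λ p → from τ (from σ p)
    ; to-cong   = λ p≋q → to-cong σ (to-cong τ p≋q)
    ; from-cong = λ p≋q → from-cong τ (from-cong σ p≋q)
    ; to-from   = λ p → ≋-trans (to-cong σ (to-from τ (from σ p))) (to-from σ p)
    ; from-to   = λ p → ≋-trans (from-cong τ (from-to σ (to τ p))) (from-to τ p)
    }

  idₚ : Perm
  idₚ = record { to = λ p → p ; from = λ p → p ; to-cong = λ p≋q → p≋q ; from-cong = λ p≋q → p≋q
               ; to-from = λ _ → ≋-refl ; from-to = λ _ → ≋-refl }

  _⁻¹ₚ : Perm → Perm
  σ ⁻¹ₚ = record { to = from σ ; from = to σ ; to-cong = from-cong σ ; from-cong = to-cong σ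
                 ; to-from = from-to σ ; from-to = to-from σ }

  PermGroup : Group 0ℓ 0ℓ
  PermGroup = record
    { Carrier = Perm ; _≈_ = _≈ₚ_ ; _∙_ = _∘ₚ_ ; ε = idₚ ; _⁻¹ = _⁻¹ₚ
    ; isGroup = record
      { isMonoid = record
        { isSemigroup = record
          { isMagma = record
            { isEquivalence = record
              { refl  = λ _ → ≋-refl
              ; sym   = λ σ≈τ p → ≋-sym (σ≈τ p)
              ; trans = λ σ≈τ τ≈υ p → ≋-trans (σ≈τ p) (τ≈υ p) }
            ; ∙-cong = λ {σ} {_} {_} {τ′} σ≈σ′ τ≈τ′ p → ≋-trans (to-cong σ (τ≈τ′ p)) (σ≈σ′ (to τ′ p)) }
          ; assoc = λ _ _ _ _ → ≋-refl }
        ; identity = (λ _ _ → ≋-refl) , (λ _ _ → ≋-refl) }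
      ; inverse = (λ σ → from-to σ) , (λ σ → to-from σ)
      ; ⁻¹-cong = λ {σ} {τ} σ≈τ p →
          ≋-trans (≋-sym (from-to τ (from σ p)))
                  (≋-trans (from-cong τ (≋-sym (σ≈τ (from σ p)))) (from-cong τ (to-from σ p))) } }

  π : Fin rank → Perm
  π s = record { to = πₛ ; from = πₛ ; to-cong = πₛ-cong ; from-cong = πₛ-cong
               ; to-from = πₛ-invol ; from-to = πₛ-invol }
    where
    πₛ : Point → Point
    πₛ (r , b) = conj (gen s) r , b xor [ r ≟ gen s ]
    πₛ-cong : ∀ {p q} → p ≋ q → πₛ p ≋ πₛ q
    πₛ-cong (r≈ , b≡) = conj-cong refl r≈ , ≡.cong₂ _xor_ b≡ (≟-cong r≈ refl)
    πₛ-invol : ∀ p → πₛ (πₛ p) ≋ p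
    πₛ-invol (r , b) = conj-gen-invol s r
      , ≡.trans (≡.cong ((b xor [ r ≟ gen s ]) xor_) sr≟s) (xor-cancelʳ b [ r ≟ gen s ])
      where
      sr≟s : [ conj (gen s) r ≟ gen s ] ≡ [ r ≟ gen s ]
      sr≟s = ≟-⇔ (mk⇔ (conj-gen-gen s r) (λ r≈s → trans (conj-cong refl r≈s) (conj-self (gen s))))

  infixr 9 _^_
  _^_ : Carrier → ℕ → Carrier
  _^_ = pow W

  ^-sucʳ : ∀ x n → x ^ suc n ≈ x ^ n ∙ x
  ^-sucʳ x zero    = trans (identityʳ x) (sym (identityˡ x))
  ^-sucʳ x (suc n) = trans (∙-congˡ (^-sucʳ x n)) (sym (assoc _ _ _))

  ^-+ : ∀ x m n → x ^ (m + n) ≈ x ^ m ∙ x ^ n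
  ^-+ x zero    n = sym (identityˡ _)
  ^-+ x (suc m) n = trans (∙-congˡ (^-+ x m n)) (sym (assoc _ _ _))

  ^-double : ∀ x k → x ^ k ∙ x ^ k ≈ x ^ (k * 2)
  ^-double x k = trans (sym (^-+ x k k)) (reflexive (≡.cong (x ^_) k+k≡k*2))
    where
    k+k≡k*2 : k + k ≡ k * 2
    k+k≡k*2 = ≡.trans (≡.cong (k +_) (≡.sym (ℕ.+-identityʳ k))) (ℕ.*-comm 2 k)

  module DihedralRelation (s t : Fin rank) where
    open ≈-Reasoning setoid

    st ts : Carrier
    st = gen s ∙ gen t
    ts = gen t ∙ gen s

    st^k⁻¹ : ∀ k → (st ^ k) ⁻¹ ≈ ts ^ k
    st^k⁻¹ k = sym (inverseʳ-unique _ _ (st^k∙ts^k k))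
      where
      st∙ts : st ∙ ts ≈ ε
      st∙ts = trans (assoc _ _ _) (trans (∙-congˡ (gen-cancelˡ t (gen s))) (gen-invol s))
      st^k∙ts^k : ∀ k → st ^ k ∙ ts ^ k ≈ ε
      st^k∙ts^k zero    = identityˡ ε
      st^k∙ts^k (suc k) = begin
        st ∙ st ^ k ∙ ts ^ suc k       ≈⟨ ∙-congˡ (^-sucʳ ts k) ⟩
        st ∙ st ^ k ∙ (ts ^ k ∙ ts)    ≈⟨ assoc _ _ _ ⟩
        st ∙ (st ^ k ∙ (ts ^ k ∙ ts))  ≈⟨ ∙-congˡ (assoc _ _ _) ⟨
        st ∙ (st ^ k ∙ ts ^ k ∙ ts)    ≈⟨ ∙-congˡ (∙-congʳ (st^k∙ts^k k)) ⟩
        st ∙ (ε ∙ ts)                  ≈⟨ ∙-congˡ (identityˡ ts) ⟩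
        st ∙ ts                        ≈⟨ st∙ts ⟩
        ε                              ∎

    t∙st^k : ∀ k → gen t ∙ st ^ k ≈ ts ^ k ∙ gen t
    t∙st^k zero    = trans (identityʳ _) (sym (identityˡ _))
    t∙st^k (suc k) = begin
      gen t ∙ (st ∙ st ^ k)      ≈⟨ assoc _ _ _ ⟨
      gen t ∙ st ∙ st ^ k        ≈⟨ ∙-congʳ (assoc _ _ _) ⟨
      ts ∙ gen t ∙ st ^ k        ≈⟨ assoc _ _ _ ⟩
      ts ∙ (gen t ∙ st ^ k)      ≈⟨ ∙-congˡ (t∙st^k k) ⟩
      ts ∙ (ts ^ k ∙ gen t)      ≈⟨ assoc _ _ _ ⟨
      ts ∙ ts ^ k ∙ gen t        ∎

    conj-st^-k : ∀ k x → conj (st ^ k ⁻¹) (x ∙ gen t) ≈ ts ^ k ∙ x ∙ ts ^ k ∙ gen t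
    conj-st^-k k x = begin
      st ^ k ⁻¹ ∙ (x ∙ gen t) ∙ st ^ k ⁻¹ ⁻¹   ≈⟨ ∙-cong (∙-congʳ (st^k⁻¹ k)) (⁻¹-involutive _) ⟩
      ts ^ k ∙ (x ∙ gen t) ∙ st ^ k            ≈⟨ ∙-congʳ (assoc _ _ _) ⟨
      ts ^ k ∙ x ∙ gen t ∙ st ^ k              ≈⟨ assoc _ _ _ ⟩
      ts ^ k ∙ x ∙ (gen t ∙ st ^ k)            ≈⟨ ∙-congˡ (t∙st^k k) ⟩
      ts ^ k ∙ x ∙ (ts ^ k ∙ gen t)            ≈⟨ assoc _ _ _ ⟨
      ts ^ k ∙ x ∙ ts ^ k ∙ gen t              ∎

    -- (π s ∘ π t)^k flips the sign of r once for each j < 2k with r = (ts)^j t; when (st)^k = 1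
    -- this condition is k-periodic in j, so the flips cancel in pairs.
    crossed : Carrier → ℕ → Bool
    crossed r j = [ r ≟ ts ^ j ∙ gen t ]

    crossed-even : ∀ k r → [ conj (st ^ k) r ≟ gen t ] ≡ crossed r (k * 2)
    crossed-even k r = ≟-⇔ (mk⇔ (λ e → trans (conj-transpose e) conj-st^-k-t) (λ e → conj-transpose⁻ (trans e (sym conj-st^-k-t))))
      where
      conj-st^-k-t : conj (st ^ k ⁻¹) (gen t) ≈ ts ^ (k * 2) ∙ gen t
      conj-st^-k-t = begin
        conj (st ^ k ⁻¹) (gen t)         ≈⟨ conj-cong refl (identityˡ _) ⟨
        conj (st ^ k ⁻¹) (ε ∙ gen t)     ≈⟨ conj-st^-k k ε ⟩
        ts ^ k ∙ ε ∙ ts ^ k ∙ gen t      ≈⟨ ∙-congʳ (∙-congʳ (identityʳ _)) ⟩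
        ts ^ k ∙ ts ^ k ∙ gen t          ≈⟨ ∙-congʳ (^-double ts k) ⟩
        ts ^ (k * 2) ∙ gen t             ∎

    crossed-odd : ∀ k r → [ conj (gen t) (conj (st ^ k) r) ≟ gen s ] ≡ crossed r (suc (k * 2))
    crossed-odd k r = ≟-⇔ (mk⇔ (λ e → trans (conj-transpose (trans (conj-transpose e) t⁻¹st≈tst)) conj-st^-k-tst)
                               (λ e → conj-transpose⁻ (trans (conj-transpose⁻ (trans e (sym conj-st^-k-tst))) (sym t⁻¹st≈tst))))
      where
      t⁻¹st≈tst : conj (gen t ⁻¹) (gen s) ≈ ts ∙ gen t
      t⁻¹st≈tst = trans (conj-cong (gen⁻¹ t) refl) (∙-congˡ (gen⁻¹ t))
      conj-st^-k-tst : conj (st ^ k ⁻¹) (ts ∙ gen t) ≈ ts ^ suc (k * 2) ∙ gen t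
      conj-st^-k-tst = begin
        conj (st ^ k ⁻¹) (ts ∙ gen t)    ≈⟨ conj-st^-k k ts ⟩
        ts ^ k ∙ ts ∙ ts ^ k ∙ gen t     ≈⟨ ∙-congʳ (∙-congʳ (^-sucʳ ts k)) ⟨
        ts ^ suc k ∙ ts ^ k ∙ gen t      ≈⟨ ∙-congʳ (assoc _ _ _) ⟩
        ts ∙ (ts ^ k ∙ ts ^ k) ∙ gen t   ≈⟨ ∙-congʳ (∙-congˡ (^-double ts k)) ⟩
        ts ^ suc (k * 2) ∙ gen t         ∎

    πst : Perm
    πst = π s ∘ₚ π t

    πst^k : ∀ k r b → to (pow PermGroup πst k) (r , b) ≋ (conj (st ^ k) r , b xor parity (crossed r) (k * 2))
    πst^k zero    r b = sym (conj-ε r) , ≡.sym (Bool.xor-identityʳ b)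
    πst^k (suc k) r b = ≋-trans (to-cong πst (πst^k k r b))
      ( sym (trans (conj-∙ st (st ^ k) r) (conj-∙ (gen s) (gen t) _))
      , ≡.trans (≡.cong₂ (λ x y → (b′ xor x) xor y) (crossed-even k r) (crossed-odd k r))
                (≡.trans (≡.cong (_xor _) (Bool.xor-assoc b _ _)) (Bool.xor-assoc b _ _)) )
      where
      b′ = b xor parity (crossed r) (k * 2)

    πst-relation : ∀ k → st ^ k ≈ ε → pow PermGroup πst k ≈ₚ idₚ
    πst-relation k st^k≈ε (r , b) = ≋-trans (πst^k k r b)
      ( trans (conj-cong st^k≈ε refl) (conj-ε r)
      , ≡.trans (≡.cong (b xor_) (parity-periodic (crossed r) k periodic)) (Bool.xor-identityʳ b) )
      where
      ts^k≈ε : ts ^ k ≈ ε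
      ts^k≈ε = trans (sym (st^k⁻¹ k)) (trans (⁻¹-cong st^k≈ε) ε⁻¹≈ε)
      periodic : ∀ j → crossed r (k + j) ≡ crossed r j
      periodic j = ≟-cong refl (∙-congʳ (trans (^-+ ts k j) (trans (∙-congʳ ts^k≈ε) (identityˡ _))))

  -- The π s satisfy the Coxeter relations, so they extend to an action of W. Comparing it with
  -- the action of an arbitrary word (act-word) shows that wordCocycle only depends on ⟦ ws ⟧.
  private
    actionOfW : Σ[ act ∈ (Carrier → Perm) ] ((∀ {x y} → x ≈ y → act x ≈ₚ act y) ×
                                             (∀ x y → act (x ∙ y) ≈ₚ act x ∘ₚ act y) ×
                                             (∀ s → act (gen s) ≈ₚ π s))
    actionOfW = presentation PermGroup π (λ s t k → DihedralRelation.πst-relation s t k)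

  act : Carrier → Perm
  act = proj₁ actionOfW

  act-cong : ∀ {x y} → x ≈ y → act x ≈ₚ act y
  act-cong = proj₁ (proj₂ actionOfW)

  act-homo : ∀ x y → act (x ∙ y) ≈ₚ act x ∘ₚ act y
  act-homo = proj₁ (proj₂ (proj₂ actionOfW))

  act-gen : ∀ s → act (gen s) ≈ₚ π s
  act-gen = proj₂ (proj₂ (proj₂ actionOfW))

  act-ε : act ε ≈ₚ idₚ
  act-ε p = ≋-trans (to-cong σ (≋-sym (to-from σ p))) (≋-trans (idempotent (from σ p)) (to-from σ p))
    where
    σ = act ε
    idempotent : ∀ p → to σ (to σ p) ≋ to σ p
    idempotent p = ≋-trans (≋-sym (act-homo ε ε p)) (act-cong (identityˡ ε) p)

  wordCocycle : ∀ {m} → Word m → Carrier → Bool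
  wordCocycle []       r = false
  wordCocycle (s ∷ ws) r = wordCocycle ws r xor [ conj ⟦ ws ⟧ r ≟ gen s ]

  act-word : ∀ {m} (ws : Word m) r b → to (act ⟦ ws ⟧) (r , b) ≋ (conj ⟦ ws ⟧ r , b xor wordCocycle ws r)
  act-word []       r b = ≋-trans (act-ε (r , b)) (sym (conj-ε r) , ≡.sym (Bool.xor-identityʳ b))
  act-word (s ∷ ws) r b = ≋-trans (act-homo (gen s) ⟦ ws ⟧ (r , b))
    (≋-trans (act-gen s _) (≋-trans (to-cong (π s) (act-word ws r b))
      (sym (conj-∙ (gen s) ⟦ ws ⟧ r) , Bool.xor-assoc b (wordCocycle ws r) _)))

  wordCocycle-≈ : ∀ {m n} (ws : Word m) (vs : Word n) r → ⟦ ws ⟧ ≈ ⟦ vs ⟧ → wordCocycle ws r ≡ wordCocycle vs r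
  wordCocycle-≈ ws vs r ws≈vs =
    proj₂ (≋-trans (≋-sym (act-word ws r false)) (≋-trans (act-cong ws≈vs (r , false)) (act-word vs r false)))

  wordCocycle-cong : ∀ {m} (ws : Word m) {r r′} → r ≈ r′ → wordCocycle ws r ≡ wordCocycle ws r′
  wordCocycle-cong []       r≈r′ = ≡.refl
  wordCocycle-cong (s ∷ ws) r≈r′ = ≡.cong₂ _xor_ (wordCocycle-cong ws r≈r′) (≟-cong (conj-cong refl r≈r′) refl)

  wordCocycle-++ : ∀ {m n} (xs : Word m) (ys : Word n) r →
                   wordCocycle (xs ++ ys) r ≡ wordCocycle ys r xor wordCocycle xs (conj ⟦ ys ⟧ r)
  wordCocycle-++ []       ys r = ≡.sym (Bool.xor-identityʳ _)
  wordCocycle-++ (x ∷ xs) ys r = ≡.trans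
    (≡.cong₂ _xor_ (wordCocycle-++ xs ys r)
                   (≟-cong (trans (conj-cong (⟦⟧-++ xs ys) refl) (conj-∙ ⟦ xs ⟧ ⟦ ys ⟧ r)) refl))
    (Bool.xor-assoc (wordCocycle ys r) _ _)

  deletion : ∀ {k} (ws : Word (suc k)) r → wordCocycle ws r ≡ true → Σ[ vs ∈ Word k ] ⟦ ws ⟧ ∙ r ≈ ⟦ vs ⟧
  deletion (s ∷ ws) r odd with wordCocycle ws r in oddʷˢ
  deletion (s ∷ [])       r odd | true with oddʷˢ
  ... | ()
  deletion (s ∷ (t ∷ ws)) r odd | true with deletion (t ∷ ws) r oddʷˢ
  ... | vs , tws∙r≈vs = s ∷ vs , trans (assoc _ _ _) (∙-congˡ tws∙r≈vs)
  deletion (s ∷ ws)       r odd | false = ws , (begin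
    gen s ∙ ⟦ ws ⟧ ∙ r                 ≈⟨ assoc _ _ _ ⟩
    gen s ∙ (⟦ ws ⟧ ∙ r)               ≈⟨ ∙-congˡ (//-rightDividesˡ ⟦ ws ⟧ (⟦ ws ⟧ ∙ r)) ⟨
    gen s ∙ (conj ⟦ ws ⟧ r ∙ ⟦ ws ⟧)   ≈⟨ ∙-congˡ (∙-congʳ (≟-true odd)) ⟩
    gen s ∙ (gen s ∙ ⟦ ws ⟧)           ≈⟨ gen-cancelˡ s _ ⟩
    ⟦ ws ⟧                             ∎)
    where open ≈-Reasoning setoid

  -- Tits' cocycle: η w r says whether r occurs an odd number of times among the reflections
  -- ⟦ vs ⟧⁻¹ s ⟦ vs ⟧ attached to the letters s of a word (… s ∷ vs) for w.
  η : Carrier → Carrier → Bool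
  η w = wordCocycle (proj₁ (ℓ-word w))

  η-word : ∀ {m} (ws : Word m) {w} r → ⟦ ws ⟧ ≈ w → η w r ≡ wordCocycle ws r
  η-word ws {w} r ws≈w = wordCocycle-≈ (proj₁ (ℓ-word w)) ws r (trans (proj₂ (ℓ-word w)) (sym ws≈w))

  η-cong : ∀ {w w′ r r′} → w ≈ w′ → r ≈ r′ → η w r ≡ η w′ r′
  η-cong {w} {w′} w≈w′ r≈r′ = ≡.trans (η-word ws′ _ (trans (proj₂ (ℓ-word w′)) (sym w≈w′)))
                                      (wordCocycle-cong ws′ r≈r′)
    where ws′ = proj₁ (ℓ-word w′)

  η-cocycle : ∀ x y r → η (x ∙ y) r ≡ η y r xor η x (conj y r)
  η-cocycle x y r = begin
    η (x ∙ y) r                                   ≡⟨ η-word (xs ++ ys) r (trans (⟦⟧-++ xs ys) (∙-cong xs≈x ys≈y)) ⟩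
    wordCocycle (xs ++ ys) r                      ≡⟨ wordCocycle-++ xs ys r ⟩
    wordCocycle ys r xor wordCocycle xs (conj ⟦ ys ⟧ r)
      ≡⟨ ≡.cong₂ _xor_ (≡.sym (η-word ys r ys≈y))
                       (≡.trans (wordCocycle-cong xs (conj-cong ys≈y refl)) (≡.sym (η-word xs _ xs≈x))) ⟩
    η y r xor η x (conj y r)                      ∎
    where
    open ≡.≡-Reasoning
    xs = proj₁ (ℓ-word x)
    xs≈x = proj₂ (ℓ-word x)
    ys = proj₁ (ℓ-word y)
    ys≈y = proj₂ (ℓ-word y)

  η-gen : ∀ s r → η (gen s) r ≡ [ r ≟ gen s ]
  η-gen s r = ≡.trans (η-word (s ∷ []) r (identityʳ _)) (≟-cong (conj-ε r) refl)

  η⇒ℓ-∙< : ∀ w r → η w r ≡ true → ℓ (w ∙ r) < ℓ w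
  η⇒ℓ-∙< w r = shorten (proj₁ (ℓ-word w)) (proj₂ (ℓ-word w))
    where
    shorten : ∀ {m} (ws : Word m) → ⟦ ws ⟧ ≈ w → wordCocycle ws r ≡ true → suc (ℓ (w ∙ r)) ≤ m
    shorten []       _     ()
    shorten (s ∷ ws) ws≈w odd with deletion (s ∷ ws) r odd
    ... | vs , sws∙r≈vs = s≤s (ℓ-minimal (vs , trans (sym sws∙r≈vs) (∙-congʳ ws≈w)))

  IsReflection : Carrier → Set
  IsReflection r = ∃[ x ] ∃[ s ] r ≈ conj x (gen s)

  gen-isReflection : ∀ s → IsReflection (gen s)
  gen-isReflection s = ε , s , sym (conj-ε (gen s))

  conj-isReflection : ∀ y {r} → IsReflection r → IsReflection (conj y r)
  conj-isReflection y {r} (x , s , r≈xs) = y ∙ x , s , trans (conj-cong refl r≈xs) (sym (conj-∙ y x (gen s)))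

  reflection-invol : ∀ {r} → IsReflection r → r ∙ r ≈ ε
  reflection-invol (x , s , r≈xs) = begin
    _ ∙ _                     ≈⟨ ∙-cong r≈xs r≈xs ⟩
    conj x (gen s) ∙ conj x (gen s)  ≈⟨ conj-homo-∙ x (gen s) (gen s) ⟩
    conj x (gen s ∙ gen s)    ≈⟨ conj-cong refl (gen-invol s) ⟩
    x ∙ ε ∙ x ⁻¹              ≈⟨ ∙-congʳ (identityʳ x) ⟩
    x ∙ x ⁻¹                  ≈⟨ inverseʳ x ⟩
    ε                         ∎
    where open ≈-Reasoning setoid

  η-reflection-self : ∀ {r} → IsReflection r → η r r ≡ true
  η-reflection-self {r} (x , s , r≈xs) = begin
    η r r                                              ≡⟨ η-cong r≈xs refl ⟩
    η (x ∙ gen s ∙ x ⁻¹) r                             ≡⟨ η-cocycle (x ∙ gen s) (x ⁻¹) r ⟩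
    η (x ⁻¹) r xor η (x ∙ gen s) (conj (x ⁻¹) r)       ≡⟨ ≡.cong₂ _xor_ η-x⁻¹ η-xs ⟩
    η x (gen s) xor (true xor η x (gen s))             ≡⟨ ≡.cong (η x (gen s) xor_) (Bool.true-xor _) ⟩
    η x (gen s) xor not (η x (gen s))               ≡⟨ Bool.xor-inverseʳ (η x (gen s)) ⟩
    true                                               ∎
    where
    open ≡.≡-Reasoning
    x⁻¹r≈s : conj (x ⁻¹) r ≈ gen s
    x⁻¹r≈s = trans (conj-cong refl r≈xs) (conj-⁻¹ˡ x (gen s))
    η-x⁻¹ : η (x ⁻¹) r ≡ η x (gen s)
    η-x⁻¹ = ≡.trans (xor≡false⇒≡ _ _ (≡.trans (≡.sym (η-cocycle x (x ⁻¹) r))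
                                    (≡.trans (η-cong (inverseʳ x) refl) (η-word [] r refl))))
                    (η-cong refl x⁻¹r≈s)
    η-xs : η (x ∙ gen s) (conj (x ⁻¹) r) ≡ true xor η x (gen s)
    η-xs = ≡.trans (η-cong refl x⁻¹r≈s) (≡.trans (η-cocycle x (gen s) (gen s))
             (≡.cong₂ _xor_ (≡.trans (η-gen s (gen s)) (dec-true (gen s ≈? gen s) refl))
                            (η-cong refl (conj-self (gen s)))))

  ℓ<ℓ-∙⇒¬η : ∀ w r → ℓ w < ℓ (w ∙ r) → η w r ≡ false
  ℓ<ℓ-∙⇒¬η w r longer with η w r in crossed
  ... | false = ≡.refl
  ... | true  = ⊥-elim (ℕ.<-asym longer (η⇒ℓ-∙< w r crossed))

  ¬η⇒ℓ<ℓ-∙ : ∀ w {r} → IsReflection r → η w r ≡ false → ℓ w < ℓ (w ∙ r)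
  ¬η⇒ℓ<ℓ-∙ w {r} isRefl notCrossed = ≡.subst (_< ℓ (w ∙ r)) (ℓ-cong w∙r∙r≈w) (η⇒ℓ-∙< (w ∙ r) r crossed)
    where
    crossed : η (w ∙ r) r ≡ true
    crossed = ≡.trans (η-cocycle w r r)
                      (≡.cong₂ _xor_ (η-reflection-self isRefl) (≡.trans (η-cong refl (conj-self r)) notCrossed))
    w∙r∙r≈w : w ∙ r ∙ r ≈ w
    w∙r∙r≈w = trans (assoc _ _ _) (trans (∙-congˡ (reflection-invol isRefl)) (identityʳ w))

  η⇒ℓ-∙gen : ∀ w s → η w (gen s) ≡ true → suc (ℓ (w ∙ gen s)) ≡ ℓ w
  η⇒ℓ-∙gen w s crossed = ℕ.≤-antisym (η⇒ℓ-∙< w (gen s) crossed) (ℓ-≤-∙gen w s)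

  ℓ-∙gen-±1 : ∀ w s → ℓ (w ∙ gen s) ≡ suc (ℓ w) ⊎ suc (ℓ (w ∙ gen s)) ≡ ℓ w
  ℓ-∙gen-±1 w s with η w (gen s) in crossed
  ... | true  = inj₂ (η⇒ℓ-∙gen w s crossed)
  ... | false = inj₁ (ℕ.≤-antisym (ℓ-∙gen w s) (¬η⇒ℓ<ℓ-∙ w (gen-isReflection s) crossed))

  rightDescent : ∀ {n} w → ℓ w ≡ suc n → ∃[ s ] ℓ (w ∙ gen s) ≡ n
  rightDescent {n} w ℓw≡1+n with leftDescent (w ⁻¹) (≡.trans (ℓ-⁻¹ w) ℓw≡1+n)
  ... | s , ℓsw⁻¹≡n = s , ≡.trans (ℓ-cong (sym ws≈[sw⁻¹]⁻¹)) (≡.trans (ℓ-⁻¹ _) ℓsw⁻¹≡n)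
    where
    ws≈[sw⁻¹]⁻¹ : (gen s ∙ w ⁻¹) ⁻¹ ≈ w ∙ gen s
    ws≈[sw⁻¹]⁻¹ = trans (⁻¹-anti-homo-∙ (gen s) (w ⁻¹)) (∙-cong (⁻¹-involutive w) (gen⁻¹ s))

  module _ {w} (longest : Longest w) where

    longest-η : ∀ {r} → IsReflection r → η w r ≡ true
    longest-η {r} isRefl with η w r in crossed
    ... | true  = ≡.refl
    ... | false = ⊥-elim (ℕ.<⇒≱ (¬η⇒ℓ<ℓ-∙ w isRefl crossed) (longest _))

    longest-ℓ-∙ : ∀ y → ℓ (w ∙ y) + ℓ y ≡ ℓ w
    longest-ℓ-∙ y = descend (ℓ y) y ≡.refl
      where
      descend : ∀ k y → ℓ y ≡ k → ℓ (w ∙ y) + k ≡ ℓ w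
      descend zero    y ℓy≡0 =
        ≡.trans (ℕ.+-identityʳ _) (ℓ-cong (trans (∙-congˡ (ℓ≡0⇒≈ε ℓy≡0)) (identityʳ w)))
      descend (suc k) y ℓy≡1+k with rightDescent y ℓy≡1+k
      ... | s , ℓys≡k = begin
        ℓ (w ∙ y) + suc k               ≡⟨ ℕ.+-suc _ k ⟩
        suc (ℓ (w ∙ y)) + k             ≡⟨ ≡.cong (λ n → suc n + k) (ℓ-cong w∙y≈w∙y′∙s) ⟩
        suc (ℓ (w ∙ y′ ∙ gen s)) + k    ≡⟨ ≡.cong (_+ k) (η⇒ℓ-∙gen (w ∙ y′) s crossed) ⟩
        ℓ (w ∙ y′) + k                  ≡⟨ descend k y′ ℓys≡k ⟩
        ℓ w                             ∎
        where
        open ≡.≡-Reasoning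
        y′ = y ∙ gen s
        w∙y≈w∙y′∙s : w ∙ y ≈ w ∙ y′ ∙ gen s
        w∙y≈w∙y′∙s = trans (∙-congˡ (sym (gen-cancelʳ y s))) (sym (assoc _ _ _))
        y′-ascends : η y′ (gen s) ≡ false
        y′-ascends = ℓ<ℓ-∙⇒¬η y′ (gen s) (≡.subst₂ _<_ (≡.sym ℓys≡k)
                       (≡.trans (≡.sym ℓy≡1+k) (ℓ-cong (sym (gen-cancelʳ y s)))) (ℕ.n<1+n k))
        crossed : η (w ∙ y′) (gen s) ≡ true
        crossed = ≡.trans (η-cocycle w y′ (gen s))
                          (≡.cong₂ _xor_ y′-ascends (longest-η (conj-isReflection y′ (gen-isReflection s))))

  longest-ℓ-\\ : ∀ {w} → Longest w → ∀ x → ℓ x + ℓ (x ⁻¹ ∙ w) ≡ ℓ w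
  longest-ℓ-\\ {w} longest x = begin
    ℓ x + ℓ (x ⁻¹ ∙ w)          ≡⟨ ≡.cong (ℓ x +_) (≡.trans (≡.sym (ℓ-⁻¹ _)) (ℓ-cong inverted)) ⟩
    ℓ x + ℓ (w ⁻¹ ∙ x)          ≡⟨ ℕ.+-comm (ℓ x) _ ⟩
    ℓ (w ⁻¹ ∙ x) + ℓ x          ≡⟨ longest-ℓ-∙ longest⁻¹ x ⟩
    ℓ (w ⁻¹)                    ≡⟨ ℓ-⁻¹ w ⟩
    ℓ w                         ∎
    where
    open ≡.≡-Reasoning
    inverted : (x ⁻¹ ∙ w) ⁻¹ ≈ w ⁻¹ ∙ x
    inverted = trans (⁻¹-anti-homo-∙ _ _) (∙-congˡ (⁻¹-involutive x))
    longest⁻¹ : Longest (w ⁻¹)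
    longest⁻¹ v = ≡.subst (ℓ v ≤_) (≡.sym (ℓ-⁻¹ w)) (longest v)


module BuildingGeometry (WS : CoxeterSystem) (_≈?_ : ∀ x y → Dec (CoxeterSystem._≈_ WS x y))
                        {N : ℕ} (Δ : Building WS N) where
  open CoxeterSystem WS
  open GroupProperties W
  open CoxeterLength WS _≈?_
  open ReflectionCocycle WS _≈?_
  open Building Δ

  δ-refl : ∀ X → δ X X ≈ ε
  δ-refl X = Equivalence.from (WD1 X X) ≡.refl

  δ≈ε⇒≡ : ∀ {X Y} → δ X Y ≈ ε → X ≡ Y
  δ≈ε⇒≡ {X} {Y} = Equivalence.to (WD1 X Y)

  δ-gen-sym : ∀ {X Y} s → δ X Y ≈ gen s → δ Y X ≈ gen s
  δ-gen-sym {X} {Y} s XY≈s with WD2 Y X X s XY≈s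
  ... | inj₁ XX≈s∙YX = trans (inverseʳ-unique (gen s) (δ Y X) (trans (sym XX≈s∙YX) (δ-refl X))) (gen⁻¹ s)
  ... | inj₂ XX≈YX with δ≈ε⇒≡ (trans (sym XX≈YX) (δ-refl X))
  ...   | ≡.refl = ⊥-elim (gen-nontriv s (trans (sym XY≈s) (δ-refl X)))

  adjacentToward : ∀ X Y s → ∃[ X′ ] δ X X′ ≈ gen s × δ X′ Y ≈ gen s ∙ δ X Y
  adjacentToward X Y s with WD3 X Y s
  ... | X′ , X′X≈s , X′Y≈s∙XY = X′ , δ-gen-sym s X′X≈s , X′Y≈s∙XY

  δ-gen-∙ : ∀ {X X′ Z} s → δ X X′ ≈ gen s → ℓ (gen s ∙ δ X′ Z) ≡ suc (ℓ (δ X′ Z)) → δ X Z ≈ gen s ∙ δ X′ Z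
  δ-gen-∙ {X} {X′} {Z} s XX′≈s longer = WD2' X′ Z X s XX′≈s λ m lengthIs →
    ≡.subst (LengthIs (gen s ∙ δ X′ Z)) (≡.trans longer (≡.cong suc (≡.sym (LengthIs⇒≡ℓ lengthIs))))
            (LengthIs-ℓ (gen s ∙ δ X′ Z))

  δ-∙ : ∀ {X Y Z a b} → δ X Y ≈ a → δ Y Z ≈ b → Reduced a b → δ X Z ≈ a ∙ b
  δ-∙ {X} {Y} {Z} {a} {b} = descend (ℓ a) ≡.refl
    where
    descend : ∀ n {X a} → ℓ a ≡ n → δ X Y ≈ a → δ Y Z ≈ b → Reduced a b → δ X Z ≈ a ∙ b
    descend zero    ℓa≡0 XY≈a YZ≈b _ with δ≈ε⇒≡ (trans XY≈a (ℓ≡0⇒≈ε ℓa≡0))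
    ... | ≡.refl = trans YZ≈b (trans (sym (identityˡ b)) (∙-congʳ (sym (ℓ≡0⇒≈ε ℓa≡0))))
    descend (suc n) {X} {a} ℓa≡1+n XY≈a YZ≈b reduced with leftDescent a ℓa≡1+n
    ... | s , ℓsa≡n with adjacentToward X Y s
    ...   | X′ , XX′≈s , X′Y≈s∙XY = trans (δ-gen-∙ s XX′≈s longer) (trans (∙-congˡ X′Z≈sab) s∙sab≈ab)
      where
      reduced′ : Reduced (gen s ∙ a) b
      reduced′ = Reduced-dropˡ s b ℓa≡1+n ℓsa≡n reduced
      X′Z≈sab : δ X′ Z ≈ gen s ∙ a ∙ b
      X′Z≈sab = descend n ℓsa≡n (trans X′Y≈s∙XY (∙-congˡ XY≈a)) YZ≈b reduced′
      s∙sab≈ab : gen s ∙ (gen s ∙ a ∙ b) ≈ a ∙ b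
      s∙sab≈ab = trans (sym (assoc _ _ _)) (∙-congʳ (gen-cancelˡ s a))
      longer : ℓ (gen s ∙ δ X′ Z) ≡ suc (ℓ (δ X′ Z))
      longer = begin
        ℓ (gen s ∙ δ X′ Z)          ≡⟨ ℓ-cong (trans (∙-congˡ X′Z≈sab) s∙sab≈ab) ⟩
        ℓ (a ∙ b)                   ≡⟨ reduced ⟩
        ℓ a + ℓ b                   ≡⟨ ≡.cong (_+ ℓ b) (≡.trans ℓa≡1+n (≡.cong suc (≡.sym ℓsa≡n))) ⟩
        suc (ℓ (gen s ∙ a) + ℓ b)   ≡⟨ ≡.cong suc (≡.trans (≡.sym reduced′) (ℓ-cong (sym X′Z≈sab))) ⟩
        suc (ℓ (δ X′ Z))            ∎
        where open ≡.≡-Reasoning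

  δ-sym : ∀ X Y → δ Y X ≈ δ X Y ⁻¹
  δ-sym X Y = descend _ X Y ≡.refl
    where
    descend : ∀ n X Y → ℓ (δ X Y) ≡ n → δ Y X ≈ δ X Y ⁻¹
    descend zero    X Y ℓXY≡0 with δ≈ε⇒≡ (ℓ≡0⇒≈ε ℓXY≡0)
    ... | ≡.refl = trans (δ-refl X) (sym (trans (⁻¹-cong (δ-refl X)) ε⁻¹≈ε))
    descend (suc n) X Y ℓXY≡1+n with leftDescent (δ X Y) ℓXY≡1+n
    ... | s , ℓsa≡n with adjacentToward X Y s
    ...   | X′ , XX′≈s , X′Y≈sa = trans (δ-∙ YX′≈[sa]⁻¹ (δ-gen-sym s XX′≈s) reduced) [sa]⁻¹s≈a⁻¹
      where
      a = δ X Y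
      YX′≈[sa]⁻¹ : δ Y X′ ≈ (gen s ∙ a) ⁻¹
      YX′≈[sa]⁻¹ = trans (descend n X′ Y (≡.trans (ℓ-cong X′Y≈sa) ℓsa≡n)) (⁻¹-cong X′Y≈sa)
      [sa]⁻¹s≈a⁻¹ : (gen s ∙ a) ⁻¹ ∙ gen s ≈ a ⁻¹
      [sa]⁻¹s≈a⁻¹ = trans (∙-congˡ (sym (gen⁻¹ s)))
                          (trans (sym (⁻¹-anti-homo-∙ (gen s) (gen s ∙ a))) (⁻¹-cong (gen-cancelˡ s a)))
      reduced : Reduced ((gen s ∙ a) ⁻¹) (gen s)
      reduced = Reduced-∙gen s (begin
        ℓ ((gen s ∙ a) ⁻¹ ∙ gen s)       ≡⟨ ℓ-cong [sa]⁻¹s≈a⁻¹ ⟩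
        ℓ (a ⁻¹)                         ≡⟨ ℓ-⁻¹ a ⟩
        ℓ a                              ≡⟨ ℓXY≡1+n ⟩
        suc n                            ≡⟨ ≡.cong suc ℓsa≡n ⟨
        suc (ℓ (gen s ∙ a))              ≡⟨ ≡.cong suc (ℓ-⁻¹ _) ⟨
        suc (ℓ ((gen s ∙ a) ⁻¹))         ∎)
        where open ≡.≡-Reasoning

  δ-factor : ∀ {Y Z a b} → δ Y Z ≈ a ∙ b → Reduced a b → ∃[ X ] δ Y X ≈ a × δ X Z ≈ b
  δ-factor {Y} {Z} {a} {b} = descend (ℓ a) ≡.refl
    where
    descend : ∀ n {Y a} → ℓ a ≡ n → δ Y Z ≈ a ∙ b → Reduced a b → ∃[ X ] δ Y X ≈ a × δ X Z ≈ b
    descend zero    {Y} {a} ℓa≡0 YZ≈ab _ =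
      Y , trans (δ-refl Y) (sym (ℓ≡0⇒≈ε ℓa≡0)) , trans YZ≈ab (trans (∙-congʳ (ℓ≡0⇒≈ε ℓa≡0)) (identityˡ b))
    descend (suc n) {Y} {a} ℓa≡1+n YZ≈ab reduced with leftDescent a ℓa≡1+n
    ... | s , ℓsa≡n with adjacentToward Y Z s
    ...   | Y′ , YY′≈s , Y′Z≈s∙YZ with descend n ℓsa≡n Y′Z≈sab reduced′
      where
      Y′Z≈sab : δ Y′ Z ≈ gen s ∙ a ∙ b
      Y′Z≈sab = trans Y′Z≈s∙YZ (trans (∙-congˡ YZ≈ab) (sym (assoc _ _ _)))
      reduced′ : Reduced (gen s ∙ a) b
      reduced′ = Reduced-dropˡ s b ℓa≡1+n ℓsa≡n reduced
    ...     | X , Y′X≈sa , XZ≈b = X , trans (δ-∙ YY′≈s Y′X≈sa s∙sa-reduced) (gen-cancelˡ s a) , XZ≈b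
      where
      s∙sa-reduced : Reduced (gen s) (gen s ∙ a)
      s∙sa-reduced = Reduced-gen∙ s (≡.trans (ℓ-cong (gen-cancelˡ s a)) (≡.trans ℓa≡1+n (≡.cong suc (≡.sym ℓsa≡n))))

  δ-factor-unique : ∀ {Y Z X X′ a b} → Reduced a b →
                    δ Y X ≈ a → δ X Z ≈ b → δ Y X′ ≈ a → δ X′ Z ≈ b → X ≡ X′
  δ-factor-unique {Y} {Z} {X} {X′} {a} {b} = descend (ℓ a) ≡.refl
    where
    descend : ∀ n {Y a} → ℓ a ≡ n → Reduced a b → δ Y X ≈ a → δ X Z ≈ b → δ Y X′ ≈ a → δ X′ Z ≈ b → X ≡ X′
    descend zero    ℓa≡0 _ YX≈a _ YX′≈a _ =
      ≡.trans (≡.sym (δ≈ε⇒≡ (trans YX≈a (ℓ≡0⇒≈ε ℓa≡0)))) (δ≈ε⇒≡ (trans YX′≈a (ℓ≡0⇒≈ε ℓa≡0)))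
    descend (suc n) {Y} {a} ℓa≡1+n reduced YX≈a XZ≈b YX′≈a X′Z≈b with leftDescent a ℓa≡1+n
    ... | s , ℓsa≡n with WD3 Y X s
    ...   | Y′ , Y′Y≈s , Y′X≈s∙YX with WD2 Y X′ Y′ s Y′Y≈s
    ...     | inj₁ Y′X′≈s∙YX′ =
      descend n ℓsa≡n reduced′ (trans Y′X≈s∙YX (∙-congˡ YX≈a)) XZ≈b (trans Y′X′≈s∙YX′ (∙-congˡ YX′≈a)) X′Z≈b
      where reduced′ = Reduced-dropˡ s b ℓa≡1+n ℓsa≡n reduced
    ...     | inj₂ Y′X′≈YX′ = ⊥-elim (ℕ.1+n≢n (begin
      suc n             ≡⟨ ℓa≡1+n ⟨
      ℓ a               ≡⟨ ℓ-cong (∙-cancelʳ b _ _ (trans (sym Y′Z≈ab) Y′Z≈sab)) ⟩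
      ℓ (gen s ∙ a)     ≡⟨ ℓsa≡n ⟩
      n                 ∎))
      where
      open ≡.≡-Reasoning
      Y′Z≈ab : δ Y′ Z ≈ a ∙ b
      Y′Z≈ab = δ-∙ (trans Y′X′≈YX′ YX′≈a) X′Z≈b reduced
      Y′Z≈sab : δ Y′ Z ≈ gen s ∙ a ∙ b
      Y′Z≈sab = δ-∙ (trans Y′X≈s∙YX (∙-congˡ YX≈a)) XZ≈b (Reduced-dropˡ s b ℓa≡1+n ℓsa≡n reduced)

  hull : Fin N → Fin N → Subset N
  hull Y Z = fromDec λ X → δ X Z ≈? (δ Y X ⁻¹ ∙ δ Y Z)

  ∈-hull : ∀ {Y Z X} → X ∈ hull Y Z ⇔ δ X Z ≈ δ Y X ⁻¹ ∙ δ Y Z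
  ∈-hull {Y} {Z} = ∈-fromDec λ X → δ X Z ≈? (δ Y X ⁻¹ ∙ δ Y Z)

  module Apartment {A} (isApartment : IsApartment A) where

    coord : Carrier → Fin N
    coord = proj₁ isApartment

    δ-coord : ∀ u v → δ (coord u) (coord v) ≈ u ⁻¹ ∙ v
    δ-coord = proj₁ (proj₂ isApartment)

    coord-∈ : ∀ u → coord u ∈ A
    coord-∈ u = Equivalence.from (proj₂ (proj₂ isApartment) (coord u)) (u , ≡.refl)

    ∈⇒coord : ∀ {X} → X ∈ A → ∃[ x ] coord x ≡ X
    ∈⇒coord {X} = Equivalence.to (proj₂ (proj₂ isApartment) X)

    realise : ∀ {X} → X ∈ A → ∀ v → ∃[ Y ] Y ∈ A × δ X Y ≈ v
    realise X∈ v with ∈⇒coord X∈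
    ... | x , ≡.refl = coord (x ∙ v) , coord-∈ (x ∙ v) , trans (δ-coord x (x ∙ v)) (\\-leftDividesʳ x v)

    δ-via : ∀ {X Y Z} → X ∈ A → Y ∈ A → Z ∈ A → δ Y Z ≈ δ X Y ⁻¹ ∙ δ X Z
    δ-via X∈ Y∈ Z∈ with ∈⇒coord X∈ | ∈⇒coord Y∈ | ∈⇒coord Z∈
    ... | x , ≡.refl | y , ≡.refl | z , ≡.refl = begin
      δ (coord y) (coord z)                                         ≈⟨ δ-coord y z ⟩
      y ⁻¹ ∙ z                                                      ≈⟨ ∙-congʳ (⁻¹-cong (\\-leftDividesˡ x y)) ⟨
      (x ∙ (x ⁻¹ ∙ y)) ⁻¹ ∙ z                                       ≈⟨ ∙-congʳ (⁻¹-anti-homo-∙ x _) ⟩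
      (x ⁻¹ ∙ y) ⁻¹ ∙ x ⁻¹ ∙ z                                      ≈⟨ assoc _ _ _ ⟩
      (x ⁻¹ ∙ y) ⁻¹ ∙ (x ⁻¹ ∙ z)                                    ≈⟨ ∙-cong (⁻¹-cong (δ-coord x y)) (δ-coord x z) ⟨
      δ (coord x) (coord y) ⁻¹ ∙ δ (coord x) (coord z)              ∎
      where open ≈-Reasoning setoid

    δ-injective : ∀ {X Y Y′} → X ∈ A → Y ∈ A → Y′ ∈ A → δ X Y ≈ δ X Y′ → Y ≡ Y′
    δ-injective {X} {Y} {Y′} X∈ Y∈ Y′∈ XY≈XY′ = δ≈ε⇒≡ (begin
      δ Y Y′                    ≈⟨ δ-via X∈ Y∈ Y′∈ ⟩
      δ X Y ⁻¹ ∙ δ X Y′         ≈⟨ ∙-congˡ XY≈XY′ ⟨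
      δ X Y ⁻¹ ∙ δ X Y          ≈⟨ inverseˡ _ ⟩
      ε                         ∎)
      where open ≈-Reasoning setoid

  module OppositePair (Y Z : Fin N) (longest : Longest (δ Y Z)) where
    private
      w = δ Y Z

    reduced : ∀ x → Reduced x (x ⁻¹ ∙ w)
    reduced x = ≡.trans (ℓ-cong (\\-leftDividesˡ x w)) (≡.sym (longest-ℓ-\\ longest x))

    private
      factor : ∀ x → ∃[ X ] δ Y X ≈ x × δ X Z ≈ x ⁻¹ ∙ w
      factor x = δ-factor (sym (\\-leftDividesˡ x w)) (reduced x)

    chamber : Carrier → Fin N
    chamber x = proj₁ (factor x)

    δ-chamberˡ : ∀ x → δ Y (chamber x) ≈ x
    δ-chamberˡ x = proj₁ (proj₂ (factor x))

    δ-chamberʳ : ∀ x → δ (chamber x) Z ≈ x ⁻¹ ∙ w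
    δ-chamberʳ x = proj₂ (proj₂ (factor x))

    chamber-unique : ∀ {x X} → δ Y X ≈ x → δ X Z ≈ x ⁻¹ ∙ w → X ≡ chamber x
    chamber-unique {x} YX≈x XZ≈x⁻¹w = δ-factor-unique (reduced x) YX≈x XZ≈x⁻¹w (δ-chamberˡ x) (δ-chamberʳ x)

    chamber-cong : ∀ {x y} → x ≈ y → chamber x ≡ chamber y
    chamber-cong x≈y = chamber-unique (trans (δ-chamberˡ _) x≈y) (trans (δ-chamberʳ _) (∙-congʳ (⁻¹-cong x≈y)))

    chamber-adjacent↑ : ∀ x s → ℓ (x ∙ gen s) ≡ suc (ℓ x) → δ (chamber x) (chamber (x ∙ gen s)) ≈ gen s
    chamber-adjacent↑ x s longer with δ-factor (δ-chamberˡ (x ∙ gen s)) (Reduced-∙gen s longer)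
    ... | X , YX≈x , X-xs≈s = ≡.subst (λ X → δ X (chamber (x ∙ gen s)) ≈ gen s) X≡chamber X-xs≈s
      where
      B = (x ∙ gen s) ⁻¹ ∙ w
      s∙B≈x⁻¹w : gen s ∙ B ≈ x ⁻¹ ∙ w
      s∙B≈x⁻¹w = trans (∙-congˡ (trans (∙-congʳ (⁻¹-anti-homo-∙ x (gen s))) (assoc _ _ _)))
                       (\\-leftDividesˡ (gen s) (x ⁻¹ ∙ w))
      lengths : ℓ x + ℓ (x ⁻¹ ∙ w) ≡ ℓ x + suc (ℓ B)
      lengths = begin
        ℓ x + ℓ (x ⁻¹ ∙ w)         ≡⟨ longest-ℓ-\\ longest x ⟩
        ℓ w                        ≡⟨ longest-ℓ-\\ longest (x ∙ gen s) ⟨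
        ℓ (x ∙ gen s) + ℓ B        ≡⟨ ≡.cong (_+ ℓ B) longer ⟩
        suc (ℓ x) + ℓ B            ≡⟨ ℕ.+-suc (ℓ x) (ℓ B) ⟨
        ℓ x + suc (ℓ B)            ∎
        where open ≡.≡-Reasoning
      s∙B-reduced : Reduced (gen s) B
      s∙B-reduced = Reduced-gen∙ s (≡.trans (ℓ-cong s∙B≈x⁻¹w) (ℕ.+-cancelˡ-≡ (ℓ x) _ _ lengths))
      X≡chamber : X ≡ chamber x
      X≡chamber = chamber-unique YX≈x (trans (δ-∙ X-xs≈s (δ-chamberʳ (x ∙ gen s)) s∙B-reduced) s∙B≈x⁻¹w)

    chamber-adjacent : ∀ x s → δ (chamber x) (chamber (x ∙ gen s)) ≈ gen s
    chamber-adjacent x s with ℓ-∙gen-±1 x s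
    ... | inj₁ longer  = chamber-adjacent↑ x s longer
    ... | inj₂ shorter = δ-gen-sym s (≡.subst (λ X → δ (chamber (x ∙ gen s)) X ≈ gen s) (chamber-cong (gen-cancelʳ x s))
                           (chamber-adjacent↑ (x ∙ gen s) s (≡.trans (ℓ-cong (gen-cancelʳ x s)) (≡.sym shorter))))

    δ-chamber : ∀ x y → δ (chamber x) (chamber y) ≈ x ⁻¹ ∙ y
    δ-chamber x y = descend _ x ≡.refl
      where
      descend : ∀ n x → ℓ (x ⁻¹ ∙ y) ≡ n → δ (chamber x) (chamber y) ≈ x ⁻¹ ∙ y
      descend zero    x ℓx⁻¹y≡0 = ≡.subst (λ X → δ (chamber x) X ≈ x ⁻¹ ∙ y) (chamber-cong x≈y)
                                          (trans (δ-refl (chamber x)) (sym (ℓ≡0⇒≈ε ℓx⁻¹y≡0)))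
        where
        x≈y : x ≈ y
        x≈y = sym (trans (sym (\\-leftDividesˡ x y)) (trans (∙-congˡ (ℓ≡0⇒≈ε ℓx⁻¹y≡0)) (identityʳ x)))
      descend (suc n) x ℓx⁻¹y≡1+n with leftDescent (x ⁻¹ ∙ y) ℓx⁻¹y≡1+n
      ... | s , ℓs∙x⁻¹y≡n = trans (δ-∙ (chamber-adjacent x s) (descend n (x ∙ gen s) ℓ[xs]⁻¹y≡n) reduced-step)
                                   s∙[xs]⁻¹y≈x⁻¹y
        where
        [xs]⁻¹y≈s∙x⁻¹y : (x ∙ gen s) ⁻¹ ∙ y ≈ gen s ∙ (x ⁻¹ ∙ y)
        [xs]⁻¹y≈s∙x⁻¹y = trans (∙-congʳ (⁻¹-anti-homo-∙ x (gen s)))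
                               (trans (assoc _ _ _) (∙-congʳ (gen⁻¹ s)))
        ℓ[xs]⁻¹y≡n : ℓ ((x ∙ gen s) ⁻¹ ∙ y) ≡ n
        ℓ[xs]⁻¹y≡n = ≡.trans (ℓ-cong [xs]⁻¹y≈s∙x⁻¹y) ℓs∙x⁻¹y≡n
        s∙[xs]⁻¹y≈x⁻¹y : gen s ∙ ((x ∙ gen s) ⁻¹ ∙ y) ≈ x ⁻¹ ∙ y
        s∙[xs]⁻¹y≈x⁻¹y = trans (∙-congˡ [xs]⁻¹y≈s∙x⁻¹y) (gen-cancelˡ s _)
        reduced-step : Reduced (gen s) ((x ∙ gen s) ⁻¹ ∙ y)
        reduced-step = Reduced-gen∙ s (≡.trans (ℓ-cong s∙[xs]⁻¹y≈x⁻¹y)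
                                               (≡.trans ℓx⁻¹y≡1+n (≡.cong suc (≡.sym ℓ[xs]⁻¹y≡n))))

    chamber-∈-hull : ∀ x → chamber x ∈ hull Y Z
    chamber-∈-hull x = Equivalence.from ∈-hull (trans (δ-chamberʳ x) (∙-congʳ (⁻¹-cong (sym (δ-chamberˡ x)))))

    hull-isApartment : IsApartment (hull Y Z)
    hull-isApartment = chamber , δ-chamber , λ X → mk⇔
      (λ X∈ → δ Y X , ≡.sym (chamber-unique refl (Equivalence.to ∈-hull X∈)))
      (λ { (x , ≡.refl) → chamber-∈-hull x })

    Y∈hull : Y ∈ hull Y Z
    Y∈hull = Equivalence.from ∈-hull (sym (trans (∙-congʳ (trans (⁻¹-cong (δ-refl Y)) ε⁻¹≈ε)) (identityˡ _)))

    Z∈hull : Z ∈ hull Y Z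
    Z∈hull = Equivalence.from ∈-hull (trans (δ-refl Z) (sym (inverseˡ w)))

    apartment≡hull : ∀ {A} → IsApartment A → Y ∈ A → Z ∈ A → A ≡ hull Y Z
    apartment≡hull {A} isApartment Y∈ Z∈ = ⊆-antisym (λ X∈ → Equivalence.from ∈-hull (δ-via Y∈ X∈ Z∈)) hull⊆A
      where
      open Apartment isApartment
      hull⊆A : ∀ {X} → X ∈ hull Y Z → X ∈ A
      hull⊆A {X} X∈hull with realise Y∈ (δ Y X)
      ... | X′ , X′∈A , YX′≈YX = ≡.subst (_∈ A) X′≡X X′∈A
        where
        X′≡X : X′ ≡ X
        X′≡X = ≡.trans (chamber-unique YX′≈YX (trans (δ-via Y∈ X′∈A Z∈) (∙-congʳ (⁻¹-cong YX′≈YX))))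
                       (≡.sym (chamber-unique refl (Equivalence.to ∈-hull X∈hull)))

  chambersAt : Fin N → Carrier → List (Fin N)
  chambersAt X u = filter (λ Y → δ X Y ≈? u) (allFin N)

  ∈-chambersAt : ∀ {X u Y} → Y ∈ₗ chambersAt X u ⇔ δ X Y ≈ u
  ∈-chambersAt {X} {u} {Y} = mk⇔ (λ Y∈ → proj₂ (∈-filter⁻ (λ Y → δ X Y ≈? u) {xs = allFin N} Y∈))
                                 (∈-filter⁺ (λ Y → δ X Y ≈? u) (∈-allFin Y))

  chambersAt-unique : ∀ X u → Unique (chambersAt X u)
  chambersAt-unique X u = Unique.filter⁺ _ (Unique.allFin⁺ N)

module _ (WS : CoxeterSystem) {N} (Δ : Building WS N) where
  open CoxeterSystem WS
  open GroupProperties W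
  open Building Δ

  apartment⇒≈-dec : ∀ {A} → IsApartment A → ∀ x y → Dec (x ≈ y)
  apartment⇒≈-dec (coord , δ-coord , _) x y =
    Dec.map′ coord-injective (λ x≈y → Equivalence.to (WD1 _ _) (δ≈ε x≈y)) (coord x Fin.≟ coord y)
    where
    δ≈ε : x ≈ y → δ (coord x) (coord y) ≈ ε
    δ≈ε x≈y = trans (δ-coord x y) (trans (∙-congˡ (sym x≈y)) (inverseˡ x))
    coord-injective : coord x ≡ coord y → x ≈ y
    coord-injective cx≡cy = sym (trans (inverseʳ-unique (x ⁻¹) y x⁻¹y≈ε) (⁻¹-involutive x))
      where
      x⁻¹y≈ε : x ⁻¹ ∙ y ≈ ε
      x⁻¹y≈ε = trans (sym (δ-coord x y)) (≡.subst (λ Y → δ (coord x) Y ≈ ε) cx≡cy (Equivalence.from (WD1 _ _) ≡.refl))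

module ApartmentCount (WS : CoxeterSystem) {N} (Δ : Building WS N) (C C̄ D : Fin N)
                      (opposite : Building.Opposite Δ C C̄)
                      {A₀ : Subset N} (A₀-isApartment : Building.IsApartment Δ A₀)
                      (C∈A₀ : C ∈ A₀) (C̄∈A₀ : C̄ ∈ A₀) (D∈A₀ : D ∈ A₀) where
  open CoxeterSystem WS
  open GroupProperties W
  open Building Δ
  open CoxeterLength WS (apartment⇒≈-dec WS Δ A₀-isApartment)
  open ReflectionCocycle WS (apartment⇒≈-dec WS Δ A₀-isApartment)
  open BuildingGeometry WS (apartment⇒≈-dec WS Δ A₀-isApartment) Δ

  u e : Carrier
  u = δ D C
  e = δ D C̄

  longest-u⁻¹e : Longest (u ⁻¹ ∙ e)
  longest-u⁻¹e = Longest-cong (Apartment.δ-via A₀-isApartment D∈A₀ C∈A₀ C̄∈A₀)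
                              λ v → opposite v _ _ (LengthIs-ℓ _) (LengthIs-ℓ v)

  u⁻¹e-reduced : Reduced (u ⁻¹) e
  u⁻¹e-reduced = ≡.trans (≡.sym (longest-ℓ-\\ longest-u⁻¹e (u ⁻¹)))
                         (≡.cong (ℓ (u ⁻¹) +_) (ℓ-cong (\\-leftDividesʳ (u ⁻¹) e)))

  module Pair {Y Z} (DY≈u : δ D Y ≈ u) (DZ≈e : δ D Z ≈ e) where

    YD≈u⁻¹ : δ Y D ≈ u ⁻¹
    YD≈u⁻¹ = trans (δ-sym D Y) (⁻¹-cong DY≈u)

    YZ≈u⁻¹e : δ Y Z ≈ u ⁻¹ ∙ e
    YZ≈u⁻¹e = δ-∙ YD≈u⁻¹ DZ≈e u⁻¹e-reduced

    open OppositePair Y Z (Longest-cong (sym YZ≈u⁻¹e) longest-u⁻¹e) public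
      using (hull-isApartment; Y∈hull; Z∈hull; apartment≡hull)

    D∈hull : D ∈ hull Y Z
    D∈hull = Equivalence.from ∈-hull (begin
      δ D Z                 ≈⟨ DZ≈e ⟩
      e                     ≈⟨ \\-leftDividesˡ u e ⟨
      u ∙ (u ⁻¹ ∙ e)        ≈⟨ ∙-cong (trans (⁻¹-cong YD≈u⁻¹) (⁻¹-involutive u)) YZ≈u⁻¹e ⟨
      δ Y D ⁻¹ ∙ δ Y Z      ∎)
      where open ≈-Reasoning setoid

  hull-injective : ∀ {Y Z Y′ Z′} → δ D Y ≈ u → δ D Z ≈ e → δ D Y′ ≈ u → δ D Z′ ≈ e →
                   hull Y Z ≡ hull Y′ Z′ → Y ≡ Y′ × Z ≡ Z′
  hull-injective DY≈u DZ≈e DY′≈u DZ′≈e YZ≡Y′Z′ =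
      δ-injective D∈hull Y∈hull (≡.subst (_ ∈_) (≡.sym YZ≡Y′Z′) (Pair.Y∈hull DY′≈u DZ′≈e)) (trans DY≈u (sym DY′≈u))
    , δ-injective D∈hull Z∈hull (≡.subst (_ ∈_) (≡.sym YZ≡Y′Z′) (Pair.Z∈hull DY′≈u DZ′≈e)) (trans DZ≈e (sym DZ′≈e))
    where
    open Pair DY≈u DZ≈e
    open Apartment hull-isApartment

  Us Es : List (Fin N)
  Us = chambersAt D u
  Es = chambersAt D e

  card-D : ∀ {c} → HasCard (λ A → IsApartment A × D ∈ A) c → c ≡ length Us * length Es
  card-D {c} card = ≡.trans (HasCard-image (λ (Y , Z) → hull Y Z)
    (Unique.cartesianProduct⁺ (chambersAt-unique D u) (chambersAt-unique D e)) injective into onto card)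
    (length-cartesianProduct Us Es)
    where
    positions : ∀ {Y Z} → (Y , Z) ∈ₗ cartesianProduct Us Es → δ D Y ≈ u × δ D Z ≈ e
    positions YZ∈ = let Y∈ , Z∈ = ∈-cartesianProduct⁻ Us Es YZ∈
                    in Equivalence.to ∈-chambersAt Y∈ , Equivalence.to ∈-chambersAt Z∈
    injective : InjectiveOn (λ (Y , Z) → hull Y Z) (cartesianProduct Us Es)
    injective YZ∈ Y′Z′∈ hull≡hull =
      let DY≈u , DZ≈e = positions YZ∈ ; DY′≈u , DZ′≈e = positions Y′Z′∈
          Y≡Y′ , Z≡Z′ = hull-injective DY≈u DZ≈e DY′≈u DZ′≈e hull≡hull
      in ≡.cong₂ _,_ Y≡Y′ Z≡Z′
    into : ∀ {YZ} → YZ ∈ₗ cartesianProduct Us Es → IsApartment (hull (proj₁ YZ) (proj₂ YZ)) × D ∈ hull (proj₁ YZ) (proj₂ YZ)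
    into YZ∈ = let open Pair (proj₁ (positions YZ∈)) (proj₂ (positions YZ∈)) in hull-isApartment , D∈hull
    onto : ∀ {A} → IsApartment A × D ∈ A → ∃[ YZ ] YZ ∈ₗ cartesianProduct Us Es × hull (proj₁ YZ) (proj₂ YZ) ≡ A
    onto (isApartment , D∈A) with Apartment.realise isApartment D∈A u | Apartment.realise isApartment D∈A e
    ... | Y , Y∈A , DY≈u | Z , Z∈A , DZ≈e =
      (Y , Z) , ∈-cartesianProduct⁺ (Equivalence.from ∈-chambersAt DY≈u) (Equivalence.from ∈-chambersAt DZ≈e)
              , ≡.sym (Pair.apartment≡hull DY≈u DZ≈e isApartment Y∈A Z∈A)

  card-CD : ∀ {a} → HasCard (λ A → IsApartment A × C ∈ A × D ∈ A) a → a ≡ length Es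
  card-CD = HasCard-image (hull C) (chambersAt-unique D e) injective into onto
    where
    injective : InjectiveOn (hull C) Es
    injective Z∈ Z′∈ hull≡hull =
      proj₂ (hull-injective refl (Equivalence.to ∈-chambersAt Z∈) refl (Equivalence.to ∈-chambersAt Z′∈) hull≡hull)
    into : ∀ {Z} → Z ∈ₗ Es → IsApartment (hull C Z) × C ∈ hull C Z × D ∈ hull C Z
    into Z∈ = let open Pair refl (Equivalence.to ∈-chambersAt Z∈) in hull-isApartment , Y∈hull , D∈hull
    onto : ∀ {A} → IsApartment A × C ∈ A × D ∈ A → ∃[ Z ] Z ∈ₗ Es × hull C Z ≡ A
    onto (isApartment , C∈A , D∈A) with Apartment.realise isApartment D∈A e
    ... | Z , Z∈A , DZ≈e =
      Z , Equivalence.from ∈-chambersAt DZ≈e , ≡.sym (Pair.apartment≡hull refl DZ≈e isApartment C∈A Z∈A)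

  card-DC̄ : ∀ {b} → HasCard (λ A → IsApartment A × D ∈ A × C̄ ∈ A) b → b ≡ length Us
  card-DC̄ = HasCard-image (λ Y → hull Y C̄) (chambersAt-unique D u) injective into onto
    where
    injective : InjectiveOn (λ Y → hull Y C̄) Us
    injective Y∈ Y′∈ hull≡hull =
      proj₁ (hull-injective (Equivalence.to ∈-chambersAt Y∈) refl (Equivalence.to ∈-chambersAt Y′∈) refl hull≡hull)
    into : ∀ {Y} → Y ∈ₗ Us → IsApartment (hull Y C̄) × D ∈ hull Y C̄ × C̄ ∈ hull Y C̄
    into Y∈ = let open Pair (Equivalence.to ∈-chambersAt Y∈) refl in hull-isApartment , D∈hull , Z∈hull
    onto : ∀ {A} → IsApartment A × D ∈ A × C̄ ∈ A → ∃[ Y ] Y ∈ₗ Us × hull Y C̄ ≡ A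
    onto (isApartment , D∈A , C̄∈A) with Apartment.realise isApartment D∈A u
    ... | Y , Y∈A , DY≈u =
      Y , Equivalence.from ∈-chambersAt DY≈u , ≡.sym (Pair.apartment≡hull DY≈u refl isApartment Y∈A C̄∈A)

lemma10p1 : (WS : CoxeterSystem) → CoxeterSystem.Finite WS →
    (N : ℕ) (Δ : Building WS N) →
    (C Cbar D : Fin N) → Building.Opposite Δ C Cbar →
    (Σ[ A ∈ Subset N ] (Building.IsApartment Δ A × C ∈ A × Cbar ∈ A × D ∈ A)) →
    (a b c : ℕ) →
    HasCard (λ A → Building.IsApartment Δ A × C ∈ A × D ∈ A) a →
    HasCard (λ A → Building.IsApartment Δ A × D ∈ A × Cbar ∈ A) b →
    HasCard (λ A → Building.IsApartment Δ A × D ∈ A) c →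
    a * b ≡ c
lemma10p1 WS _ N Δ C Cbar D opposite (A₀ , A₀-isApartment , C∈A₀ , Cbar∈A₀ , D∈A₀) a b c card-a card-b card-c =
  begin
    a * b                        ≡⟨ ≡.cong₂ _*_ (card-CD card-a) (card-DC̄ card-b) ⟩
    length Es * length Us        ≡⟨ ℕ.*-comm (length Es) (length Us) ⟩
    length Us * length Es        ≡⟨ card-D card-c ⟨
    c                            ∎
  where
  open ≡.≡-Reasoning
  open ApartmentCount WS Δ C Cbar D opposite A₀-isApartment C∈A₀ Cbar∈A₀ D∈A₀
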